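{- Let $r \geq 1$ and $k \geq 1$ be integers and let $n$ be a positive integer. Let $G$ be a $k$-partite $k$-uniform hypergraph with parts $U_1, \ldots, U_k$ such that $|U_i| = n^{r^i}$ for $1 \leq i \leq k$, and suppose $G$ has exactly $a \prod_{i=2}^{k}|U_i|$ edges, where $a \geq r$ is a real number. Then $G$ contains at least $\binom{a}{r}\prod_{i=1}^{k-1}\binom{|U_i|}{r}$ copies of $K^{(k)}_{r,\ldots,r}$.
   Context: A $k$-partite $k$-uniform hypergraph with parts $U_1,\ldots,U_k$ is a hypergraph on the vertex set $U_1 \cup \cdots \cup U_k$ (disjoint union) each of whose edges consists of exactly one vertex from each $U_i$. $K^{(k)}_{r,\ldots,r}$ denotes the complete $k$-partite $k$-uniform hypergraph with $k$ parts each of size $r$ (all $k$-sets meeting each part in one vertex). A copy of $K^{(k)}_{r,\ldots,r}$ in $G$ is a subhypergraph of $G$ isomorphic to it. For real $a$, $\binom{a}{r} = a(a-1)\cdots(a-r+1)/r!$. Empty products equal $1$. -}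

module Defs where

open import Data.Nat using (ℕ; zero; suc; _+_; _∸_; _^_)
open import Data.Nat.Combinatorics using (_C_)
open import Data.Integer using (ℤ; +_)
open import Data.Rational using (ℚ; _/_; _*_; _-_; 1ℚ)
open import Data.Fin using (Fin; toℕ; _≟_)
open import Data.Fin.Subset using (Subset; _∈_; _∩_; ∣_∣)
open import Data.Vec using (Vec; lookup; tabulate)
open import Data.List using (List; map; upTo)
open import Data.Nat.ListAction using (product)
open import Data.Product using (_×_; Σ; ∃)
open import Relation.Binary.PropositionalEquality using (_≡_)
open import Relation.Nullary.Decidable using (does)

ℕ→ℚ : ℕ → ℚ
ℕ→ℚ m = + m / 1

-- generalized binomial coefficient  (a choose r) = a(a-1)...(a-r+1)/r!
-- via  (a choose (r+1)) = (a choose r) * (a - r) / (r+1)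
chooseℚ : ℚ → ℕ → ℚ
chooseℚ a zero    = 1ℚ
chooseℚ a (suc r) = chooseℚ a r * (a - ℕ→ℚ r) * (+ 1 / suc r)

infix 3 _⇔_
_⇔_ : Set → Set → Set
A ⇔ B = (A → B) × (B → A)

DistinctEdges : ∀ {M m} → Vec (Subset M) m → Set
DistinctEdges {m = m} E = (j j′ : Fin m) → lookup E j ≡ lookup E j′ → j ≡ j′

-- The vertex class U_{i+1} determined by a part assignment.
partSet : ∀ {M k} → (Fin M → Fin k) → Fin k → Subset M
partSet part i = tabulate (λ v → does (part v ≟ i))

IsKPartite : ∀ {M m k} → Vec (Subset M) m → (Fin M → Fin k) → Set
IsKPartite {m = m} {k = k} E part =
  (j : Fin m) (i : Fin k) → ∣ lookup E j ∩ partSet part i ∣ ≡ 1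

-- (W , F) is a copy of K^{(k)}_{r,...,r} in the hypergraph E:
-- W is a vertex subset, F a subset of the edges of E (by index),
-- (W , F) is a subhypergraph, and there is an isomorphism
-- φ : V(K) = Fin k × Fin r → W such that the edges of K
-- (choice functions c : Fin k → Fin r, i.e. {(i , c i)}) map exactly onto F.
IsCopyOfK : ∀ {M m} → (k r : ℕ) → Vec (Subset M) m → Subset M → Subset m → Set
IsCopyOfK {M} {m} k r E W F =
  ((j : Fin m) → j ∈ F → (v : Fin M) → v ∈ lookup E j → v ∈ W) ×
  Σ (Fin k → Fin r → Fin M) λ φ →
      ((i i′ : Fin k) (t t′ : Fin r) → φ i t ≡ φ i′ t′ → (i ≡ i′ × t ≡ t′)) ×
      ((v : Fin M) → (v ∈ W) ⇔ (∃ λ i → ∃ λ t → φ i t ≡ v)) ×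
      ((c : Fin k → Fin r) → ∃ λ j → j ∈ F ×
          ((v : Fin M) → (v ∈ lookup E j) ⇔ (∃ λ i → φ i (c i) ≡ v))) ×
      ((j : Fin m) → j ∈ F → ∃ λ (c : Fin k → Fin r) →
          ((v : Fin M) → (v ∈ lookup E j) ⇔ (∃ λ i → φ i (c i) ≡ v)))

-- ∏_{i=2}^{k} n^{r^i}
prodU2k : ℕ → ℕ → ℕ → ℕ
prodU2k n r k = product (map (λ j → n ^ (r ^ (2 + j))) (upTo (k ∸ 1)))

-- ∏_{i=1}^{k-1} binom(n^{r^i}, r)
prodBinom1k : ℕ → ℕ → ℕ → ℕ
prodBinom1k n r k = product (map (λ j → (n ^ (r ^ (1 + j))) C r) (upTo (k ∸ 1)))

module Submission where

-- A configuration picks a set of vertices in every part U_i; it is complete when all its transversals are edges,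
-- and a complete configuration of r-sets spans a copy of K_{r,...,r}. The complete configurations of single
-- vertices are the m = a * |U_2| * ... * |U_k| edges. Replace the single vertices of U_1, ..., U_k by r-sets, one
-- part after the other. With the other parts fixed, the complete r-sets in U_i are the r-subsets of the common
-- neighbourhood, binom(d, r) many if it has size d; by Jensen's inequality for d |-> binom(d, r), their total is
-- at least N * binom(a, r) when the N choices in the other parts have average degree at least a. Since
-- |U_(i+1)| = |U_i|^r and a * binom(|U_i|, r) <= binom(a, r) * |U_i|^r, the average degree over the next part is
-- again at least a, and after the last part the count of complete configurations is the claimed bound.

module RationalBinomial where

  open import Data.Nat as ℕ using (ℕ; zero; suc; _∸_; _!; _^_)
  import Data.Nat.Properties as ℕ
  open import Data.Nat.Tactic.RingSolver using (solve-∀)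
  open import Data.Nat.Combinatorics using (_C_; nCk+nC[k+1]≡[n+1]C[k+1]; nCk≡nC[n∸k]; nCn≡1)
  open import Data.Nat.Coprimality using (1-coprimeTo; sym)
  open import Data.Integer as ℤ using (+_)
  import Data.Integer.Properties as ℤ
  open import Data.Rational
  open import Data.Rational.Properties
  open import Data.Rational.Solver using (module +-*-Solver)
  open import Relation.Nullary using (yes; no)
  open import Relation.Binary.PropositionalEquality using (_≡_; refl; cong; cong₂; trans; subst; subst₂; module ≡-Reasoning)
    renaming (sym to ≡-sym)
  open import Defs using (ℕ→ℚ; chooseℚ)

  open +-*-Solver

  ℕ→ℚ≡mkℚ : ∀ m → ℕ→ℚ m ≡ mkℚ (+ m) 0 (sym (1-coprimeTo m))
  ℕ→ℚ≡mkℚ m = ↥p/↧p≡p (mkℚ (+ m) 0 (sym (1-coprimeTo m)))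

  ℕ→ℚ-+ : ∀ m n → ℕ→ℚ (m ℕ.+ n) ≡ ℕ→ℚ m + ℕ→ℚ n
  ℕ→ℚ-+ m n rewrite ℕ→ℚ≡mkℚ m | ℕ→ℚ≡mkℚ n =
    /-cong (cong₂ ℤ._+_ (≡-sym (ℤ.*-identityʳ (+ m))) (≡-sym (ℤ.*-identityʳ (+ n)))) refl

  ℕ→ℚ-* : ∀ m n → ℕ→ℚ (m ℕ.* n) ≡ ℕ→ℚ m * ℕ→ℚ n
  ℕ→ℚ-* m n rewrite ℕ→ℚ≡mkℚ m | ℕ→ℚ≡mkℚ n = /-cong (ℤ.pos-* m n) refl

  ℕ→ℚ-suc : ∀ n → ℕ→ℚ (suc n) ≡ 1ℚ + ℕ→ℚ n
  ℕ→ℚ-suc = ℕ→ℚ-+ 1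

  ℕ→ℚ-mono-≤ : ∀ {m n} → m ℕ.≤ n → ℕ→ℚ m ≤ ℕ→ℚ n
  ℕ→ℚ-mono-≤ {m} {n} m≤n rewrite ℕ→ℚ≡mkℚ m | ℕ→ℚ≡mkℚ n = *≤* (ℤ.*-monoʳ-≤-nonNeg (+ 1) (ℤ.+≤+ m≤n))

  ℕ→ℚ-nonNeg : ∀ n → 0ℚ ≤ ℕ→ℚ n
  ℕ→ℚ-nonNeg n = ℕ→ℚ-mono-≤ {0} {n} ℕ.z≤n

  ℕ→ℚ-pos : ∀ n → Positive (ℕ→ℚ (suc n))
  ℕ→ℚ-pos n = normalize-pos (suc n) 1

  p≤q⇒0≤q-p : ∀ {p q} → p ≤ q → 0ℚ ≤ q - p
  p≤q⇒0≤q-p {p} {q} p≤q = subst (_≤ q - p) (+-inverseʳ p) (+-monoˡ-≤ (- p) p≤q)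

  0≤q-p⇒p≤q : ∀ {p q} → 0ℚ ≤ q - p → p ≤ q
  0≤q-p⇒p≤q {p} {q} 0≤q-p =
    subst₂ _≤_ (+-identityˡ p) (solve 2 (λ p q → (q :- p) :+ p := q) refl p q) (+-monoˡ-≤ p 0≤q-p)

  *-nonNeg : ∀ {p q} → 0ℚ ≤ p → 0ℚ ≤ q → 0ℚ ≤ p * q
  *-nonNeg {p} {q} 0≤p 0≤q =
    nonNegative⁻¹ (p * q) {{nonNeg*nonNeg⇒nonNeg p {{nonNegative 0≤p}} q {{nonNegative 0≤q}}}}

  *-monoʳ-≤-0≤ : ∀ {r p q} → 0ℚ ≤ r → p ≤ q → p * r ≤ q * r
  *-monoʳ-≤-0≤ {r} 0≤r = *-monoʳ-≤-nonNeg r {{nonNegative 0≤r}}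

  *-monoˡ-≤-0≤ : ∀ {r p q} → 0ℚ ≤ r → p ≤ q → r * p ≤ r * q
  *-monoˡ-≤-0≤ {r} 0≤r = *-monoˡ-≤-nonNeg r {{nonNegative 0≤r}}

  *-mono-≤-nonNeg : ∀ {p p′ q q′} → 0ℚ ≤ p → 0ℚ ≤ q′ → p ≤ p′ → q ≤ q′ → p * q ≤ p′ * q′
  *-mono-≤-nonNeg {p} {p′} {q} {q′} 0≤p 0≤q′ p≤p′ q≤q′ =
    ≤-trans (*-monoˡ-≤-0≤ 0≤p q≤q′) (*-monoʳ-≤-0≤ 0≤q′ p≤p′)

  ℕ→ℚ-∸ : ∀ {m n} → n ℕ.≤ m → ℕ→ℚ m - ℕ→ℚ n ≡ ℕ→ℚ (m ∸ n)
  ℕ→ℚ-∸ {m} {n} n≤m = begin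
    ℕ→ℚ m - ℕ→ℚ n                  ≡⟨ cong (λ z → ℕ→ℚ z - ℕ→ℚ n) (≡-sym (ℕ.m∸n+n≡m n≤m)) ⟩
    ℕ→ℚ (m ∸ n ℕ.+ n) - ℕ→ℚ n      ≡⟨ cong (_- ℕ→ℚ n) (ℕ→ℚ-+ (m ∸ n) n) ⟩
    ℕ→ℚ (m ∸ n) + ℕ→ℚ n - ℕ→ℚ n    ≡⟨ solve 2 (λ d n → d :+ n :- n := d) refl (ℕ→ℚ (m ∸ n)) (ℕ→ℚ n) ⟩
    ℕ→ℚ (m ∸ n)                    ∎
    where open ≡-Reasoning

  1/suc : ℕ → ℚ
  1/suc n = + 1 / suc n

  1/suc-inverseˡ : ∀ n → 1/suc n * ℕ→ℚ (suc n) ≡ 1ℚ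
  1/suc-inverseˡ n =
    trans (cong₂ _*_ 1/suc≡mkℚ (ℕ→ℚ≡mkℚ (suc n))) (*-inverseˡ (mkℚ (+ suc n) 0 (sym (1-coprimeTo (suc n)))))
    where
    1/suc≡mkℚ : 1/suc n ≡ mkℚ (+ 1) n (1-coprimeTo (suc n))
    1/suc≡mkℚ = ↥p/↧p≡p (mkℚ (+ 1) n (1-coprimeTo (suc n)))

  1/suc-nonNeg : ∀ n → 0ℚ ≤ 1/suc n
  1/suc-nonNeg n = nonNegative⁻¹ (1/suc n) {{normalize-nonNeg 1 (suc n)}}

  -- Pascal's recurrence, which the counting arguments unfold definitionally; binomial≡C identifies it with _C_.
  binomial : ℕ → ℕ → ℕ
  binomial n       zero    = 1
  binomial zero    (suc k) = 0
  binomial (suc n) (suc k) = binomial n k ℕ.+ binomial n (suc k)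

  binomial≡C : ∀ n k → binomial n k ≡ n C k
  binomial≡C n       zero    = ≡-sym (trans (nCk≡nC[n∸k] {0} {n} ℕ.z≤n) (nCn≡1 n))
  binomial≡C zero    (suc k) = refl
  binomial≡C (suc n) (suc k) =
    trans (cong₂ ℕ._+_ (binomial≡C n k) (binomial≡C n (suc k))) (nCk+nC[k+1]≡[n+1]C[k+1] n k)

  binomial[n,1]≡n : ∀ n → binomial n 1 ≡ n
  binomial[n,1]≡n zero    = refl
  binomial[n,1]≡n (suc n) = cong suc (binomial[n,1]≡n n)

  n<k⇒binomial[n,k]≡0 : ∀ {n k} → n ℕ.< k → binomial n k ≡ 0
  n<k⇒binomial[n,k]≡0 {zero}  {suc k} _             = refl
  n<k⇒binomial[n,k]≡0 {suc n} {suc k} (ℕ.s≤s n<k) =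
    cong₂ ℕ._+_ (n<k⇒binomial[n,k]≡0 n<k) (n<k⇒binomial[n,k]≡0 (ℕ.m<n⇒m<1+n n<k))

  binomial-monoˡ-≤ : ∀ {n n′} k → n ℕ.≤ n′ → binomial n k ℕ.≤ binomial n′ k
  binomial-monoˡ-≤ zero    _               = ℕ.≤-refl
  binomial-monoˡ-≤ (suc k) ℕ.z≤n           = ℕ.z≤n
  binomial-monoˡ-≤ (suc k) (ℕ.s≤s n≤n′) =
    ℕ.+-mono-≤ (binomial-monoˡ-≤ k n≤n′) (binomial-monoˡ-≤ (suc k) n≤n′)

  [1+k]*binomial[n,1+k]≡[n∸k]*binomial[n,k] : ∀ n k → suc k ℕ.* binomial n (suc k) ≡ (n ∸ k) ℕ.* binomial n k
  [1+k]*binomial[n,1+k]≡[n∸k]*binomial[n,k] zero k rewrite ℕ.*-zeroʳ k | ℕ.0∸n≡0 k = refl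
  [1+k]*binomial[n,1+k]≡[n∸k]*binomial[n,k] (suc n) zero
    rewrite binomial[n,1]≡n n | ℕ.+-identityʳ n | ℕ.*-identityʳ n = refl
  [1+k]*binomial[n,1+k]≡[n∸k]*binomial[n,k] (suc n) (suc k) with k ℕ.<? n
  ... | yes k<n = begin
    (2 ℕ.+ k) ℕ.* (B (suc k) ℕ.+ B (2 ℕ.+ k))
      ≡⟨ ℕ.*-distribˡ-+ (2 ℕ.+ k) (B (suc k)) (B (2 ℕ.+ k)) ⟩
    (2 ℕ.+ k) ℕ.* B (suc k) ℕ.+ (2 ℕ.+ k) ℕ.* B (2 ℕ.+ k)
      ≡⟨ cong ((2 ℕ.+ k) ℕ.* B (suc k) ℕ.+_) ([1+k]*binomial[n,1+k]≡[n∸k]*binomial[n,k] n (suc k)) ⟩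
    (2 ℕ.+ k) ℕ.* B (suc k) ℕ.+ (n ∸ suc k) ℕ.* B (suc k)
      ≡⟨ regroup k (n ∸ suc k) (B (suc k)) ⟩
    suc k ℕ.* B (suc k) ℕ.+ suc (n ∸ suc k) ℕ.* B (suc k)
      ≡⟨ cong₂ ℕ._+_ ([1+k]*binomial[n,1+k]≡[n∸k]*binomial[n,k] n k) (cong (ℕ._* B (suc k)) (≡-sym (ℕ.+-∸-assoc 1 k<n))) ⟩
    (n ∸ k) ℕ.* B k ℕ.+ (n ∸ k) ℕ.* B (suc k)
      ≡⟨ ℕ.*-distribˡ-+ (n ∸ k) (B k) (B (suc k)) ⟨
    (n ∸ k) ℕ.* (B k ℕ.+ B (suc k)) ∎
    where
    open ≡-Reasoning
    B = binomial n
    regroup : ∀ k d b → (2 ℕ.+ k) ℕ.* b ℕ.+ d ℕ.* b ≡ suc k ℕ.* b ℕ.+ suc d ℕ.* b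
    regroup = solve-∀
  ... | no k≮n
    rewrite n<k⇒binomial[n,k]≡0 {n} {suc k} (ℕ.s≤s (ℕ.≮⇒≥ k≮n))
          | n<k⇒binomial[n,k]≡0 {n} {2 ℕ.+ k} (ℕ.s≤s (ℕ.m≤n⇒m≤1+n (ℕ.≮⇒≥ k≮n)))
          | ℕ.m≤n⇒m∸n≡0 (ℕ.≮⇒≥ k≮n) = ℕ.*-zeroʳ (2 ℕ.+ k)

  binomial[n,k]*k!≤n^k : ∀ n k → binomial n k ℕ.* k ! ℕ.≤ n ^ k
  binomial[n,k]*k!≤n^k n zero    = ℕ.≤-refl
  binomial[n,k]*k!≤n^k n (suc k) = begin
    binomial n (suc k) ℕ.* (suc k ℕ.* k !)   ≡⟨ ℕ.*-assoc (binomial n (suc k)) (suc k) (k !) ⟨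
    binomial n (suc k) ℕ.* suc k ℕ.* k !     ≡⟨ cong (ℕ._* k !) (trans (ℕ.*-comm (binomial n (suc k)) (suc k))
                                                    ([1+k]*binomial[n,1+k]≡[n∸k]*binomial[n,k] n k)) ⟩
    (n ∸ k) ℕ.* binomial n k ℕ.* k !         ≡⟨ ℕ.*-assoc (n ∸ k) (binomial n k) (k !) ⟩
    (n ∸ k) ℕ.* (binomial n k ℕ.* k !)       ≤⟨ ℕ.*-mono-≤ (ℕ.m∸n≤m n k) (binomial[n,k]*k!≤n^k n k) ⟩
    n ℕ.* n ^ k                             ∎
    where open ℕ.≤-Reasoning

  chooseℚ[n,r]≡binomial[n,r] : ∀ n r → chooseℚ (ℕ→ℚ n) r ≡ ℕ→ℚ (binomial n r)
  chooseℚ[n,r]≡binomial[n,r] n zero    = refl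
  chooseℚ[n,r]≡binomial[n,r] n (suc r) with r ℕ.≤? n
  ... | yes r≤n = begin
    chooseℚ (ℕ→ℚ n) r * (ℕ→ℚ n - ℕ→ℚ r) * 1/suc r
      ≡⟨ cong₂ (λ x y → x * y * 1/suc r) (chooseℚ[n,r]≡binomial[n,r] n r) (ℕ→ℚ-∸ r≤n) ⟩
    ℕ→ℚ (binomial n r) * ℕ→ℚ (n ∸ r) * 1/suc r
      ≡⟨ cong (_* 1/suc r) (ℕ→ℚ-* (binomial n r) (n ∸ r)) ⟨
    ℕ→ℚ (binomial n r ℕ.* (n ∸ r)) * 1/suc r
      ≡⟨ cong (λ z → ℕ→ℚ z * 1/suc r) (trans (ℕ.*-comm (binomial n r) (n ∸ r))
                                             (≡-sym ([1+k]*binomial[n,1+k]≡[n∸k]*binomial[n,k] n r))) ⟩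
    ℕ→ℚ (suc r ℕ.* binomial n (suc r)) * 1/suc r
      ≡⟨ cong (_* 1/suc r) (ℕ→ℚ-* (suc r) (binomial n (suc r))) ⟩
    ℕ→ℚ (suc r) * ℕ→ℚ (binomial n (suc r)) * 1/suc r
      ≡⟨ solve 3 (λ s b c → s :* b :* c := b :* (c :* s)) refl (ℕ→ℚ (suc r)) (ℕ→ℚ (binomial n (suc r))) (1/suc r) ⟩
    ℕ→ℚ (binomial n (suc r)) * (1/suc r * ℕ→ℚ (suc r))
      ≡⟨ cong (ℕ→ℚ (binomial n (suc r)) *_) (1/suc-inverseˡ r) ⟩
    ℕ→ℚ (binomial n (suc r)) * 1ℚ
      ≡⟨ *-identityʳ _ ⟩
    ℕ→ℚ (binomial n (suc r)) ∎
    where open ≡-Reasoning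
  ... | no r≰n
    rewrite chooseℚ[n,r]≡binomial[n,r] n r
          | n<k⇒binomial[n,k]≡0 (ℕ.≰⇒> r≰n)
          | n<k⇒binomial[n,k]≡0 (ℕ.m<n⇒m<1+n (ℕ.≰⇒> r≰n))
          | *-zeroˡ (ℕ→ℚ n - ℕ→ℚ r) = *-zeroˡ (1/suc r)

  chooseℚ-nonNeg : ∀ r {a} → ℕ→ℚ r ≤ a → 0ℚ ≤ chooseℚ a r
  chooseℚ-nonNeg zero    _    = nonNegative⁻¹ 1ℚ
  chooseℚ-nonNeg (suc r) 1+r≤a = *-nonNeg (*-nonNeg (chooseℚ-nonNeg r r≤a) (p≤q⇒0≤q-p r≤a)) (1/suc-nonNeg r)
    where r≤a = ≤-trans (ℕ→ℚ-mono-≤ (ℕ.n≤1+n r)) 1+r≤a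

  fallingℚ : ℚ → ℕ → ℚ
  fallingℚ a zero    = 1ℚ
  fallingℚ a (suc r) = fallingℚ a r * (a - ℕ→ℚ r)

  chooseℚ[a,r]*r!≡fallingℚ[a,r] : ∀ a r → chooseℚ a r * ℕ→ℚ (r !) ≡ fallingℚ a r
  chooseℚ[a,r]*r!≡fallingℚ[a,r] a zero    = *-identityʳ 1ℚ
  chooseℚ[a,r]*r!≡fallingℚ[a,r] a (suc r) = begin
    chooseℚ a r * (a - ℕ→ℚ r) * 1/suc r * ℕ→ℚ (suc r ℕ.* r !)
      ≡⟨ cong (chooseℚ a r * (a - ℕ→ℚ r) * 1/suc r *_) (ℕ→ℚ-* (suc r) (r !)) ⟩
    chooseℚ a r * (a - ℕ→ℚ r) * 1/suc r * (ℕ→ℚ (suc r) * ℕ→ℚ (r !))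
      ≡⟨ solve 5 (λ c d e s f → c :* d :* e :* (s :* f) := c :* f :* d :* (e :* s))
           refl (chooseℚ a r) (a - ℕ→ℚ r) (1/suc r) (ℕ→ℚ (suc r)) (ℕ→ℚ (r !)) ⟩
    chooseℚ a r * ℕ→ℚ (r !) * (a - ℕ→ℚ r) * (1/suc r * ℕ→ℚ (suc r))
      ≡⟨ cong₂ (λ x y → x * (a - ℕ→ℚ r) * y) (chooseℚ[a,r]*r!≡fallingℚ[a,r] a r) (1/suc-inverseˡ r) ⟩
    fallingℚ a r * (a - ℕ→ℚ r) * 1ℚ
      ≡⟨ *-identityʳ _ ⟩
    fallingℚ a r * (a - ℕ→ℚ r) ∎
    where open ≡-Reasoning

  a≤fallingℚ[a,1+r] : ∀ r {a} → ℕ→ℚ (suc r) ≤ a → a ≤ fallingℚ a (suc r)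
  a≤fallingℚ[a,1+r] zero {a} _ =
    ≤-reflexive (≡-sym (trans (*-identityˡ (a - 0ℚ)) (solve 1 (λ a → a :- con 0ℚ := a) refl a)))
  a≤fallingℚ[a,1+r] (suc r) {a} 2+r≤a = begin
    a                                 ≡⟨ *-identityʳ a ⟨
    a * 1ℚ                            ≤⟨ *-mono-≤-nonNeg 0≤a (≤-trans (nonNegative⁻¹ 1ℚ) 1≤a-[1+r]) 
                                           (a≤fallingℚ[a,1+r] r 1+r≤a) 1≤a-[1+r] ⟩
    fallingℚ a (suc r) * (a - ℕ→ℚ (suc r)) ∎
    where
    open ≤-Reasoning
    1+r≤a = ≤-trans (ℕ→ℚ-mono-≤ (ℕ.n≤1+n (suc r))) 2+r≤a
    0≤a = ≤-trans (ℕ→ℚ-nonNeg (suc r)) 1+r≤a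
    1≤a-[1+r] : 1ℚ ≤ a - ℕ→ℚ (suc r)
    1≤a-[1+r] = 0≤q-p⇒p≤q (subst (0ℚ ≤_)
      (trans (cong (λ z → a - z) (ℕ→ℚ-suc (suc r)))
             (solve 2 (λ a s → a :- (con 1ℚ :+ s) := a :- s :- con 1ℚ) refl a (ℕ→ℚ (suc r))))
      (p≤q⇒0≤q-p 2+r≤a))

  -- Multiplied by s!, this follows from s! · binomial N s ≤ N ^ s and a ≤ a (a - 1) ⋯ (a - s + 1) for a ≥ s.
  a*binomial[N,s]≤chooseℚ[a,s]*N^s : ∀ s {a} N → .{{_ : ℕ.NonZero s}} → ℕ→ℚ s ≤ a →
    a * ℕ→ℚ (binomial N s) ≤ chooseℚ a s * ℕ→ℚ (N ^ s)
  a*binomial[N,s]≤chooseℚ[a,s]*N^s (suc r) {a} N s≤a = *-cancelʳ-≤-pos (ℕ→ℚ (s !)) {{s!-pos}} (begin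
    a * ℕ→ℚ (binomial N s) * ℕ→ℚ (s !)
      ≡⟨ trans (*-assoc a _ _) (cong (a *_) (≡-sym (ℕ→ℚ-* (binomial N s) (s !)))) ⟩
    a * ℕ→ℚ (binomial N s ℕ.* s !)
      ≤⟨ *-monoˡ-≤-0≤ (≤-trans (ℕ→ℚ-nonNeg s) s≤a) (ℕ→ℚ-mono-≤ (binomial[n,k]*k!≤n^k N s)) ⟩
    a * ℕ→ℚ (N ^ s)
      ≤⟨ *-monoʳ-≤-0≤ (ℕ→ℚ-nonNeg (N ^ s)) (a≤fallingℚ[a,1+r] r s≤a) ⟩
    fallingℚ a s * ℕ→ℚ (N ^ s)
      ≡⟨ cong (_* ℕ→ℚ (N ^ s)) (chooseℚ[a,r]*r!≡fallingℚ[a,r] a s) ⟨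
    chooseℚ a s * ℕ→ℚ (s !) * ℕ→ℚ (N ^ s)
      ≡⟨ solve 3 (λ c f p → c :* f :* p := c :* p :* f) refl (chooseℚ a s) (ℕ→ℚ (s !)) (ℕ→ℚ (N ^ s)) ⟩
    chooseℚ a s * ℕ→ℚ (N ^ s) * ℕ→ℚ (s !) ∎)
    where
    open ≤-Reasoning
    s = suc r
    s!-pos : Positive (ℕ→ℚ (s !))
    s!-pos = normalize-pos (s !) 1 {{_}} {{ℕ._!≢0 s}}

  [c*binomial[n,s]*p]*a≤[c*n^s*p]*chooseℚ[a,s] : ∀ s {a} c n p → .{{_ : ℕ.NonZero s}} → ℕ→ℚ s ≤ a →
    ℕ→ℚ (c ℕ.* binomial n s ℕ.* p) * a ≤ ℕ→ℚ (c ℕ.* (n ^ s ℕ.* p)) * chooseℚ a s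
  [c*binomial[n,s]*p]*a≤[c*n^s*p]*chooseℚ[a,s] s {a} c n p s≤a = begin
    ℕ→ℚ (c ℕ.* binomial n s ℕ.* p) * a
      ≡⟨ cong (_* a) (trans (ℕ→ℚ-* (c ℕ.* binomial n s) p) (cong (_* ℕ→ℚ p) (ℕ→ℚ-* c (binomial n s)))) ⟩
    ℕ→ℚ c * ℕ→ℚ (binomial n s) * ℕ→ℚ p * a
      ≡⟨ solve 4 (λ c b p a → c :* b :* p :* a := a :* b :* (c :* p)) refl (ℕ→ℚ c) (ℕ→ℚ (binomial n s)) (ℕ→ℚ p) a ⟩
    a * ℕ→ℚ (binomial n s) * (ℕ→ℚ c * ℕ→ℚ p)
      ≤⟨ *-monoʳ-≤-0≤ (*-nonNeg (ℕ→ℚ-nonNeg c) (ℕ→ℚ-nonNeg p)) (a*binomial[N,s]≤chooseℚ[a,s]*N^s s n s≤a) ⟩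
    chooseℚ a s * ℕ→ℚ (n ^ s) * (ℕ→ℚ c * ℕ→ℚ p)
      ≡⟨ solve 4 (λ y m c p → y :* m :* (c :* p) := c :* (m :* p) :* y) refl (chooseℚ a s) (ℕ→ℚ (n ^ s)) (ℕ→ℚ c) (ℕ→ℚ p) ⟩
    ℕ→ℚ c * (ℕ→ℚ (n ^ s) * ℕ→ℚ p) * chooseℚ a s
      ≡⟨ cong (_* chooseℚ a s) (trans (ℕ→ℚ-* c (n ^ s ℕ.* p)) (cong (ℕ→ℚ c *_) (ℕ→ℚ-* (n ^ s) p))) ⟨
    ℕ→ℚ (c ℕ.* (n ^ s ℕ.* p)) * chooseℚ a s ∎
    where open ≤-Reasoning

module Choices where

  open import Level using (0ℓ)
  open import Algebra.Bundles using (CommutativeMonoid)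
  open import Data.Bool using (T)
  open import Data.Nat as ℕ using (ℕ; zero; suc)
  import Data.Nat.Properties as ℕ
  open import Data.Nat.ListAction using (product)
  open import Data.Fin using (Fin; zero; suc)
  open import Data.List using (List; []; _∷_; _++_; map; foldr; length; cartesianProductWith; tabulate)
  open import Data.List.Properties using (length-++; length-map; ∷-injective; map-∘; map-id-local)
  open import Data.List.Membership.Propositional using (_∈_)
  open import Data.List.Membership.Propositional.Properties using (∈-cartesianProductWith⁺; ∈-cartesianProductWith⁻)
  open import Data.List.Relation.Unary.Any using (here; there)
  open import Data.List.Relation.Unary.All as All using (All; []; _∷_)
  import Data.List.Relation.Unary.AllPairs as AllPairs
  open import Data.List.Relation.Unary.Unique.Propositional using (Unique)
  import Data.List.Relation.Unary.Unique.Propositional.Properties as Unique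
  open import Data.List.Relation.Binary.Pointwise using (Pointwise; []; _∷_)
  open import Data.Product using (∃; _×_; _,_)
  open import Function using (_∘_; _⇔_; mk⇔)
  open import Relation.Nullary using (Dec; does; yes; no)
  open import Relation.Binary.PropositionalEquality using (_≡_; refl; cong; cong₂; trans; sym; subst; module ≡-Reasoning)

  private variable
    A B C : Set

  T-does⇔ : ∀ {P : Set} (P? : Dec P) → T (does P?) ⇔ P
  T-does⇔ (yes p) = mk⇔ (λ _ → p) (λ _ → _)
  T-does⇔ (no ¬p) = mk⇔ (λ ()) ¬p

  choices : List (List A) → List (List A)
  choices []       = [] ∷ []
  choices (X ∷ Xs) = cartesianProductWith _∷_ X (choices Xs)

  length-cartesianProductWith : ∀ (f : A → B → C) xs ys →
    length (cartesianProductWith f xs ys) ≡ length xs ℕ.* length ys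
  length-cartesianProductWith f []       ys = refl
  length-cartesianProductWith f (x ∷ xs) ys rewrite length-++ (map (f x) ys) {cartesianProductWith f xs ys} =
    cong₂ ℕ._+_ (length-map (f x) ys) (length-cartesianProductWith f xs ys)

  length-choices : (Xs : List (List A)) → length (choices Xs) ≡ product (map length Xs)
  length-choices []       = refl
  length-choices (X ∷ Xs) =
    trans (length-cartesianProductWith _∷_ X (choices Xs)) (cong (length X ℕ.*_) (length-choices Xs))

  length-choices-++ : ∀ (Xs Ys : List (List A)) → length (choices (Xs ++ Ys)) ≡ length (choices Xs) ℕ.* length (choices Ys)
  length-choices-++ []       Ys = sym (ℕ.+-identityʳ _)
  length-choices-++ (X ∷ Xs) Ys = begin
    length (choices (X ∷ Xs ++ Ys))
      ≡⟨ length-cartesianProductWith _∷_ X (choices (Xs ++ Ys)) ⟩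
    length X ℕ.* length (choices (Xs ++ Ys))
      ≡⟨ cong (length X ℕ.*_) (length-choices-++ Xs Ys) ⟩
    length X ℕ.* (length (choices Xs) ℕ.* length (choices Ys))
      ≡⟨ ℕ.*-assoc (length X) _ _ ⟨
    length X ℕ.* length (choices Xs) ℕ.* length (choices Ys)
      ≡⟨ cong (ℕ._* length (choices Ys)) (length-cartesianProductWith _∷_ X (choices Xs)) ⟨
    length (choices (X ∷ Xs)) ℕ.* length (choices Ys) ∎
    where open ≡-Reasoning

  ∈-choices⁺ : ∀ {c} {Xs : List (List A)} → Pointwise _∈_ c Xs → c ∈ choices Xs
  ∈-choices⁺ []         = here refl
  ∈-choices⁺ (x∈X ∷ c∈) = ∈-cartesianProductWith⁺ _∷_ x∈X (∈-choices⁺ c∈)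

  ∈-choices⁻ : ∀ {c} (Xs : List (List A)) → c ∈ choices Xs → Pointwise _∈_ c Xs
  ∈-choices⁻ []       (here refl) = []
  ∈-choices⁻ (X ∷ Xs) c∈ with ∈-cartesianProductWith⁻ _∷_ X (choices Xs) c∈
  ... | x , c′ , x∈X , c′∈ , refl = x∈X ∷ ∈-choices⁻ Xs c′∈

  ∈-choices-tabulate⁻ : ∀ {n} {c} (G : Fin n → List A) → c ∈ choices (tabulate G) →
    ∃ λ f → c ≡ tabulate f × (∀ i → f i ∈ G i)
  ∈-choices-tabulate⁻ G c∈ = pointwise⇒tabulate G (∈-choices⁻ (tabulate G) c∈)
    where
    pointwise⇒tabulate : ∀ {n} {c} (G : Fin n → List A) → Pointwise _∈_ c (tabulate G) →
      ∃ λ f → c ≡ tabulate f × (∀ i → f i ∈ G i)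
    pointwise⇒tabulate {n = zero}  G []          = (λ ()) , refl , λ ()
    pointwise⇒tabulate {n = suc n} G (x∈ ∷ c∈) with pointwise⇒tabulate (G ∘ suc) c∈
    ... | f , refl , f∈ = (λ { zero → _ ; (suc i) → f i }) , refl , λ { zero → x∈ ; (suc i) → f∈ i }

  choices⁺ : {Xs : List (List A)} → All Unique Xs → Unique (choices Xs)
  choices⁺ []         = [] AllPairs.∷ AllPairs.[]
  choices⁺ (X! ∷ Xs!) = Unique.cartesianProductWith⁺ _∷_ ∷-injective X! (choices⁺ Xs!)

  -- Stated for an arbitrary commutative monoid so that it serves both sums of naturals and Boolean
  -- conjunctions: ⨁ unfolds to sum ∘ map and to all respectively.
  module BigOperator (M : CommutativeMonoid 0ℓ 0ℓ) where
    open CommutativeMonoid M using (_≈_; _∙_; ε; ∙-cong; ∙-congˡ; assoc; identityˡ; identityʳ; setoid; commutativeSemigroup)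
      renaming (Carrier to R; refl to ≈-refl; sym to ≈-sym; trans to ≈-trans)
    open import Relation.Binary.Reasoning.Setoid setoid
    open import Algebra.Properties.CommutativeSemigroup commutativeSemigroup using (interchange)

    ⨁ : List A → (A → R) → R
    ⨁ xs f = foldr _∙_ ε (map f xs)

    ⨁-cong : ∀ (xs : List A) {f g : A → R} → (∀ x → f x ≈ g x) → ⨁ xs f ≈ ⨁ xs g
    ⨁-cong []       f≈g = ≈-refl
    ⨁-cong (x ∷ xs) f≈g = ∙-cong (f≈g x) (⨁-cong xs f≈g)

    ⨁-cong-∈ : ∀ (xs : List A) {f g : A → R} → (∀ {x} → x ∈ xs → f x ≈ g x) → ⨁ xs f ≈ ⨁ xs g
    ⨁-cong-∈ []       f≈g = ≈-refl
    ⨁-cong-∈ (x ∷ xs) f≈g = ∙-cong (f≈g (here refl)) (⨁-cong-∈ xs (f≈g ∘ there))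

    ⨁-++ : ∀ (xs ys : List A) (f : A → R) → ⨁ (xs ++ ys) f ≈ ⨁ xs f ∙ ⨁ ys f
    ⨁-++ []       ys f = ≈-sym (identityˡ _)
    ⨁-++ (x ∷ xs) ys f = ≈-trans (∙-congˡ (⨁-++ xs ys f)) (≈-sym (assoc _ _ _))

    ⨁-map : ∀ (g : A → B) xs (f : B → R) → ⨁ (map g xs) f ≈ ⨁ xs (λ x → f (g x))
    ⨁-map g []       f = ≈-refl
    ⨁-map g (x ∷ xs) f = ∙-congˡ (⨁-map g xs f)

    ⨁-ε : ∀ (xs : List A) → ⨁ xs (λ _ → ε) ≈ ε
    ⨁-ε []       = ≈-refl
    ⨁-ε (x ∷ xs) = ≈-trans (identityˡ _) (⨁-ε xs)

    ⨁-∙ : ∀ (xs : List A) (f g : A → R) → ⨁ xs (λ x → f x ∙ g x) ≈ ⨁ xs f ∙ ⨁ xs g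
    ⨁-∙ []       f g = ≈-sym (identityˡ ε)
    ⨁-∙ (x ∷ xs) f g = ≈-trans (∙-congˡ (⨁-∙ xs f g)) (interchange _ _ _ _)

    ⨁-swap : ∀ (xs : List A) (ys : List B) (f : A → B → R) →
      ⨁ xs (λ x → ⨁ ys (f x)) ≈ ⨁ ys (λ y → ⨁ xs (λ x → f x y))
    ⨁-swap []       ys f = ≈-sym (⨁-ε ys)
    ⨁-swap (x ∷ xs) ys f = ≈-trans (∙-congˡ (⨁-swap xs ys f)) (≈-sym (⨁-∙ ys (f x) (λ y → ⨁ xs (λ x → f x y))))

    ⨁-cartesianProductWith : ∀ (g : A → B → C) xs ys (f : C → R) →
      ⨁ (cartesianProductWith g xs ys) f ≈ ⨁ xs (λ x → ⨁ ys (λ y → f (g x y)))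
    ⨁-cartesianProductWith g []       ys f = ≈-refl
    ⨁-cartesianProductWith g (x ∷ xs) ys f =
      ≈-trans (⨁-++ (map (g x) ys) _ f) (∙-cong (⨁-map (g x) ys f) (⨁-cartesianProductWith g xs ys f))

    ⨁-choices-++ : ∀ (Xs Ys : List (List A)) (f : List A → R) →
      ⨁ (choices (Xs ++ Ys)) f ≈ ⨁ (choices Xs) (λ c → ⨁ (choices Ys) (λ d → f (c ++ d)))
    ⨁-choices-++ []       Ys f = ≈-sym (identityʳ _)
    ⨁-choices-++ (X ∷ Xs) Ys f = begin
      ⨁ (choices (X ∷ Xs ++ Ys)) f
        ≈⟨ ⨁-cartesianProductWith _∷_ X (choices (Xs ++ Ys)) f ⟩
      ⨁ X (λ x → ⨁ (choices (Xs ++ Ys)) (λ ρ → f (x ∷ ρ)))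
        ≈⟨ ⨁-cong X (λ x → ⨁-choices-++ Xs Ys (λ ρ → f (x ∷ ρ))) ⟩
      ⨁ X (λ x → ⨁ (choices Xs) (λ c → ⨁ (choices Ys) (λ d → f (x ∷ c ++ d))))
        ≈⟨ ⨁-cartesianProductWith _∷_ X (choices Xs) (λ c → ⨁ (choices Ys) (λ d → f (c ++ d))) ⟨
      ⨁ (choices (X ∷ Xs)) (λ c → ⨁ (choices Ys) (λ d → f (c ++ d))) ∎

    ⨁-choices-insert : ∀ (Xs : List (List A)) Y Ys (f : List A → R) →
      ⨁ (choices (Xs ++ Y ∷ Ys)) f ≈ ⨁ (choices Xs) (λ c → ⨁ (choices Ys) (λ d → ⨁ Y (λ y → f (c ++ y ∷ d))))
    ⨁-choices-insert Xs Y Ys f = begin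
      ⨁ (choices (Xs ++ Y ∷ Ys)) f
        ≈⟨ ⨁-choices-++ Xs (Y ∷ Ys) f ⟩
      ⨁ (choices Xs) (λ c → ⨁ (choices (Y ∷ Ys)) (λ d → f (c ++ d)))
        ≈⟨ ⨁-cong (choices Xs) (λ c → ⨁-cartesianProductWith _∷_ Y (choices Ys) (λ d → f (c ++ d))) ⟩
      ⨁ (choices Xs) (λ c → ⨁ Y (λ y → ⨁ (choices Ys) (λ d → f (c ++ y ∷ d))))
        ≈⟨ ⨁-cong (choices Xs) (λ c → ⨁-swap Y (choices Ys) (λ y d → f (c ++ y ∷ d))) ⟩
      ⨁ (choices Xs) (λ c → ⨁ (choices Ys) (λ d → ⨁ Y (λ y → f (c ++ y ∷ d)))) ∎

    ⨁-choices-split : ∀ (Xs : List (List A)) Y Ys (f : List A → R) →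
      ⨁ (choices (Xs ++ Y ∷ Ys)) f ≈ ⨁ Y (λ y → ⨁ (choices (Xs ++ (y ∷ []) ∷ Ys)) f)
    ⨁-choices-split Xs Y Ys f = begin
      ⨁ (choices (Xs ++ Y ∷ Ys)) f
        ≈⟨ ⨁-choices-insert Xs Y Ys f ⟩
      ⨁ (choices Xs) (λ c → ⨁ (choices Ys) (λ d → ⨁ Y (λ y → f (c ++ y ∷ d))))
        ≈⟨ ⨁-cong (choices Xs) (λ c → ⨁-swap (choices Ys) Y (λ d y → f (c ++ y ∷ d))) ⟩
      ⨁ (choices Xs) (λ c → ⨁ Y (λ y → ⨁ (choices Ys) (λ d → f (c ++ y ∷ d))))
        ≈⟨ ⨁-swap (choices Xs) Y (λ c y → ⨁ (choices Ys) (λ d → f (c ++ y ∷ d))) ⟩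
      ⨁ Y (λ y → ⨁ (choices Xs) (λ c → ⨁ (choices Ys) (λ d → f (c ++ y ∷ d))))
        ≈⟨ ⨁-cong Y (λ y → ⨁-cong (choices Xs) (λ c → ⨁-cong (choices Ys) (λ d → identityʳ _))) ⟨
      ⨁ Y (λ y → ⨁ (choices Xs) (λ c → ⨁ (choices Ys) (λ d → f (c ++ y ∷ d) ∙ ε)))
        ≈⟨ ⨁-cong Y (λ y → ⨁-choices-insert Xs (y ∷ []) Ys f) ⟨
      ⨁ Y (λ y → ⨁ (choices (Xs ++ (y ∷ []) ∷ Ys)) f) ∎

  map⁺-retraction : ∀ {f : A → B} (g : B → A) {xs} → (∀ {x} → x ∈ xs → g (f x) ≡ x) →
    Unique xs → Unique (map f xs)
  map⁺-retraction {f = f} g {xs} g∘f≡id xs! = Unique.map⁻ {f = g} {xs = map f xs}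
    (subst Unique (sym (trans (sym (map-∘ xs)) (map-id-local (All.tabulate g∘f≡id)))) xs!)

module Combinations where

  open import Data.Bool using (Bool; T)
  open import Data.Bool.Properties using (T?)
  open import Data.Nat as ℕ using (ℕ; zero; suc)
  open import Data.List using (List; []; _∷_; _++_; map; length; filterᵇ)
  open import Data.List.Properties using (length-++; length-map; ∷-injectiveʳ; filter-accept; filter-reject; filter-none)
  open import Data.List.Membership.Propositional using (_∈_)
  open import Data.List.Membership.Propositional.Properties using (∈-map⁻; ∈-++⁻)
  open import Data.List.Relation.Unary.Any using (here; there)
  open import Data.List.Relation.Unary.All as All using (All)
  open import Data.List.Relation.Unary.All.Properties using (¬Any⇒All¬)
  open import Data.List.Relation.Unary.AllPairs using ([]; _∷_)
  open import Data.List.Relation.Unary.Unique.Propositional using (Unique)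
  open import Data.List.Relation.Unary.Unique.Propositional.Properties using (++⁺; map⁺; Unique[x∷xs]⇒x∉xs)
  open import Data.List.Relation.Binary.Subset.Propositional using (_⊆_)
  open import Data.Product using (∃; _×_; _,_)
  open import Data.Sum using (_⊎_; inj₁; inj₂)
  open import Function using (_∘_; case_of_)
  open import Relation.Nullary using (¬_; contradiction)
  open import Relation.Binary.PropositionalEquality using (_≡_; refl; cong; cong₂; trans)
  open RationalBinomial using (binomial)

  private variable
    A : Set

  combinations : ℕ → List A → List (List A)
  combinations zero    xs       = [] ∷ []
  combinations (suc r) []       = []
  combinations (suc r) (x ∷ xs) = map (x ∷_) (combinations r xs) ++ combinations (suc r) xs

  length-combinations : ∀ r (xs : List A) → length (combinations r xs) ≡ binomial (length xs) r
  length-combinations zero    xs       = refl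
  length-combinations (suc r) []       = refl
  length-combinations (suc r) (x ∷ xs) =
    trans (length-++ (map (x ∷_) (combinations r xs)))
          (cong₂ ℕ._+_ (trans (length-map (x ∷_) (combinations r xs)) (length-combinations r xs))
                       (length-combinations (suc r) xs))

  ∈-combinations⁻ : ∀ r (x : A) xs {S} → S ∈ combinations (suc r) (x ∷ xs) →
    (∃ λ S′ → S′ ∈ combinations r xs × S ≡ x ∷ S′) ⊎ S ∈ combinations (suc r) xs
  ∈-combinations⁻ r x xs S∈ with ∈-++⁻ (map (x ∷_) (combinations r xs)) S∈
  ... | inj₁ S∈map = inj₁ (∈-map⁻ (x ∷_) S∈map)
  ... | inj₂ S∈    = inj₂ S∈

  ∈-combinations⇒length : ∀ r (xs : List A) {S} → S ∈ combinations r xs → length S ≡ r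
  ∈-combinations⇒length zero    xs       (here refl) = refl
  ∈-combinations⇒length (suc r) (x ∷ xs) S∈ with ∈-combinations⁻ r x xs S∈
  ... | inj₁ (S′ , S′∈ , refl) = cong suc (∈-combinations⇒length r xs S′∈)
  ... | inj₂ S∈′               = ∈-combinations⇒length (suc r) xs S∈′

  ∈-combinations⇒⊆ : ∀ r (xs : List A) {S} → S ∈ combinations r xs → S ⊆ xs
  ∈-combinations⇒⊆ zero    xs       (here refl) ()
  ∈-combinations⇒⊆ (suc r) (x ∷ xs) S∈ v∈S with ∈-combinations⁻ r x xs S∈
  ∈-combinations⇒⊆ (suc r) (x ∷ xs) S∈ (here refl)  | inj₁ (S′ , S′∈ , refl) = here refl
  ∈-combinations⇒⊆ (suc r) (x ∷ xs) S∈ (there v∈S′) | inj₁ (S′ , S′∈ , refl) = there (∈-combinations⇒⊆ r xs S′∈ v∈S′)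
  ... | inj₂ S∈′ = there (∈-combinations⇒⊆ (suc r) xs S∈′ v∈S)

  ∈-combinations⇒Unique : ∀ r {xs : List A} {S} → Unique xs → S ∈ combinations r xs → Unique S
  ∈-combinations⇒Unique zero    _           (here refl) = []
  ∈-combinations⇒Unique (suc r) {x ∷ xs} (x∉ ∷ xs!) S∈ with ∈-combinations⁻ r x xs S∈
  ... | inj₁ (S′ , S′∈ , refl) =
    ¬Any⇒All¬ S′ (λ x∈S′ → Unique[x∷xs]⇒x∉xs (x∉ ∷ xs!) (∈-combinations⇒⊆ r xs S′∈ x∈S′))
    ∷ ∈-combinations⇒Unique r xs! S′∈
  ... | inj₂ S∈′ = ∈-combinations⇒Unique (suc r) xs! S∈′

  combinations⁺ : ∀ r {xs : List A} → Unique xs → Unique (combinations r xs)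
  combinations⁺ zero    _  = All.[] ∷ []
  combinations⁺ (suc r) {[]}     _  = []
  combinations⁺ (suc r) {x ∷ xs} x∷xs! with x∷xs!
  ... | x∉ ∷ xs! = ++⁺ (map⁺ ∷-injectiveʳ (combinations⁺ r xs!)) (combinations⁺ (suc r) xs!) disjoint
    where
    disjoint : ∀ {S} → ¬ (S ∈ map (x ∷_) (combinations r xs) × S ∈ combinations (suc r) xs)
    disjoint (S∈map , S∈) with ∈-map⁻ (x ∷_) S∈map
    ... | S′ , _ , refl = Unique[x∷xs]⇒x∉xs x∷xs! (∈-combinations⇒⊆ (suc r) xs S∈ (here refl))

  filterᵇ-combinations : ∀ (p : A → Bool) r {xs S} → Unique xs → S ∈ combinations r xs →
    (∀ {v} → v ∈ xs → T (p v) → v ∈ S) → (∀ {v} → v ∈ S → T (p v)) → filterᵇ p xs ≡ S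
  filterᵇ-combinations p zero {xs} _ (here refl) p⇒∈ _ =
    filter-none (T? ∘ p) (All.tabulate (λ v∈xs pv → case p⇒∈ v∈xs pv of λ ()))
  filterᵇ-combinations p (suc r) {x ∷ xs} x∷xs!@(_ ∷ xs!) S∈ p⇒∈ ∈⇒p with ∈-combinations⁻ r x xs S∈
  ... | inj₁ (S′ , S′∈ , refl) =
    trans (filter-accept (T? ∘ p) (∈⇒p (here refl)))
          (cong (x ∷_) (filterᵇ-combinations p r xs! S′∈ p⇒∈S′ (λ v∈S′ → ∈⇒p (there v∈S′))))
    where
    p⇒∈S′ : ∀ {v} → v ∈ xs → T (p v) → v ∈ S′
    p⇒∈S′ v∈xs pv with p⇒∈ (there v∈xs) pv
    ... | here refl = contradiction v∈xs (Unique[x∷xs]⇒x∉xs x∷xs!)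
    ... | there v∈S′ = v∈S′
  ... | inj₂ S∈′ =
    trans (filter-reject (T? ∘ p) (Unique[x∷xs]⇒x∉xs x∷xs! ∘ ∈-combinations⇒⊆ (suc r) xs S∈′ ∘ p⇒∈ (here refl)))
          (filterᵇ-combinations p (suc r) xs! S∈′ (λ v∈xs → p⇒∈ (there v∈xs)) ∈⇒p)

module Jensen where

  open import Data.Nat as ℕ using (ℕ; zero; suc)
  import Data.Nat.Properties as ℕ
  open import Data.Rational
  open import Data.Rational.Properties
  open import Data.Rational.Solver using (module +-*-Solver)
  open import Data.List using (List; []; _∷_; length)
  open import Data.Sum using (inj₁; inj₂)
  open import Function using (id; _∘_)
  open import Relation.Binary.Definitions using (Monotonic₁)
  open import Relation.Binary.PropositionalEquality using (_≡_; refl; cong; trans; subst; module ≡-Reasoning)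
    renaming (sym to ≡-sym)
  open import Defs using (ℕ→ℚ; chooseℚ)
  open RationalBinomial
  open Choices using (module BigOperator)

  open +-*-Solver

  open BigOperator ℕ.+-0-commutativeMonoid using () renaming (⨁ to ∑)
  open BigOperator +-0-commutativeMonoid using ()
    renaming (⨁ to ∑ℚ; ⨁-cong to ∑ℚ-cong; ⨁-∙ to ∑ℚ-+)

  ℕ→ℚ-∑ : ∀ {A : Set} (xs : List A) f → ℕ→ℚ (∑ xs f) ≡ ∑ℚ xs (λ x → ℕ→ℚ (f x))
  ℕ→ℚ-∑ []       f = refl
  ℕ→ℚ-∑ (x ∷ xs) f = trans (ℕ→ℚ-+ (f x) (∑ xs f)) (cong (ℕ→ℚ (f x) +_) (ℕ→ℚ-∑ xs f))

  ∑ℚ-*ʳ : ∀ {A : Set} (xs : List A) f c → ∑ℚ xs (λ x → f x * c) ≡ ∑ℚ xs f * c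
  ∑ℚ-*ʳ []       f c = ≡-sym (*-zeroˡ c)
  ∑ℚ-*ʳ (x ∷ xs) f c = trans (cong (f x * c +_) (∑ℚ-*ʳ xs f c)) (≡-sym (*-distribʳ-+ c (f x) (∑ℚ xs f)))

  ∑ℚ-const : ∀ {A : Set} (xs : List A) c → ∑ℚ xs (λ _ → c) ≡ ℕ→ℚ (length xs) * c
  ∑ℚ-const []       c = ≡-sym (*-zeroˡ c)
  ∑ℚ-const (x ∷ xs) c = begin
    c + ∑ℚ xs (λ _ → c)               ≡⟨ cong (c +_) (∑ℚ-const xs c) ⟩
    c + ℕ→ℚ (length xs) * c           ≡⟨ solve 2 (λ c n → c :+ n :* c := (con 1ℚ :+ n) :* c) refl c (ℕ→ℚ (length xs)) ⟩
    (1ℚ + ℕ→ℚ (length xs)) * c        ≡⟨ cong (_* c) (ℕ→ℚ-suc (length xs)) ⟨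
    ℕ→ℚ (suc (length xs)) * c         ∎
    where open ≡-Reasoning

  ∑ℚ-nonNeg : ∀ {A : Set} (xs : List A) f → (∀ x → 0ℚ ≤ f x) → 0ℚ ≤ ∑ℚ xs f
  ∑ℚ-nonNeg []       f 0≤f = ≤-refl
  ∑ℚ-nonNeg (x ∷ xs) f 0≤f = +-mono-≤ (0≤f x) (∑ℚ-nonNeg xs f 0≤f)

  module _ {f g : ℕ → ℚ} where

    ∑ℚ-cross : ∀ x hs → ∑ℚ hs (λ y → (f x - f y) * (g x - g y)) ≡
      ℕ→ℚ (length hs) * f x * g x + ∑ℚ hs (λ y → f y * g y) - f x * ∑ℚ hs g - ∑ℚ hs f * g x
    ∑ℚ-cross x []       = solve 2 (λ a b → con 0ℚ := con 0ℚ :* a :* b :+ con 0ℚ :- a :* con 0ℚ :- con 0ℚ :* b) refl (f x) (g x)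
    ∑ℚ-cross x (y ∷ hs) = begin
      (f x - f y) * (g x - g y) + ∑ℚ hs (λ y → (f x - f y) * (g x - g y))
        ≡⟨ cong ((f x - f y) * (g x - g y) +_) (∑ℚ-cross x hs) ⟩
      (f x - f y) * (g x - g y) + (n * f x * g x + ∑ℚ hs (λ y → f y * g y) - f x * ∑ℚ hs g - ∑ℚ hs f * g x)
        ≡⟨ solve 8 (λ a b c d n p q s → (a :- c) :* (b :- d) :+ (n :* a :* b :+ p :- a :* q :- s :* b)
                     := (con 1ℚ :+ n) :* a :* b :+ (c :* d :+ p) :- a :* (d :+ q) :- (c :+ s) :* b)
             refl (f x) (g x) (f y) (g y) n (∑ℚ hs (λ y → f y * g y)) (∑ℚ hs g) (∑ℚ hs f) ⟩
      (1ℚ + n) * f x * g x + ∑ℚ (y ∷ hs) (λ y → f y * g y) - f x * ∑ℚ (y ∷ hs) g - ∑ℚ (y ∷ hs) f * g x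
        ≡⟨ cong (λ m → m * f x * g x + ∑ℚ (y ∷ hs) (λ y → f y * g y) - f x * ∑ℚ (y ∷ hs) g - ∑ℚ (y ∷ hs) f * g x)
                (ℕ→ℚ-suc (length hs)) ⟨
      ℕ→ℚ (suc (length hs)) * f x * g x + ∑ℚ (y ∷ hs) (λ y → f y * g y) - f x * ∑ℚ (y ∷ hs) g - ∑ℚ (y ∷ hs) f * g x ∎
      where
      open ≡-Reasoning
      n = ℕ→ℚ (length hs)

    module _ (f-mono : Monotonic₁ ℕ._≤_ _≤_ f) (g-mono : Monotonic₁ ℕ._≤_ _≤_ g) where

      comonotone-nonNeg : ∀ x y → 0ℚ ≤ (f x - f y) * (g x - g y)
      comonotone-nonNeg x y with ℕ.≤-total x y
      ... | inj₁ x≤y = subst (0ℚ ≤_)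
              (solve 4 (λ a b c d → (c :- a) :* (d :- b) := (a :- c) :* (b :- d)) refl (f x) (g x) (f y) (g y))
              (*-nonNeg (p≤q⇒0≤q-p (f-mono x≤y)) (p≤q⇒0≤q-p (g-mono x≤y)))
      ... | inj₂ y≤x = *-nonNeg (p≤q⇒0≤q-p (f-mono y≤x)) (p≤q⇒0≤q-p (g-mono y≤x))

      chebyshev : ∀ hs → ∑ℚ hs f * ∑ℚ hs g ≤ ℕ→ℚ (length hs) * ∑ℚ hs (λ h → f h * g h)
      chebyshev []       = ≤-reflexive (trans (*-zeroˡ 0ℚ) (≡-sym (*-zeroˡ 0ℚ)))
      chebyshev (x ∷ hs) = 0≤q-p⇒p≤q (subst (0ℚ ≤_) regroup
        (+-mono-≤ (p≤q⇒0≤q-p (chebyshev hs))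
                  (subst (0ℚ ≤_) (∑ℚ-cross x hs) (∑ℚ-nonNeg hs _ (comonotone-nonNeg x)))))
        where
        n = ℕ→ℚ (length hs)
        regroup : n * ∑ℚ hs (λ h → f h * g h) - ∑ℚ hs f * ∑ℚ hs g +
                  (n * f x * g x + ∑ℚ hs (λ y → f y * g y) - f x * ∑ℚ hs g - ∑ℚ hs f * g x)
                ≡ ℕ→ℚ (suc (length hs)) * ∑ℚ (x ∷ hs) (λ h → f h * g h) - ∑ℚ (x ∷ hs) f * ∑ℚ (x ∷ hs) g
        regroup = trans
          (solve 6 (λ n p s t a b → n :* p :- s :* t :+ (n :* a :* b :+ p :- a :* t :- s :* b)
                     := (con 1ℚ :+ n) :* (a :* b :+ p) :- (a :+ s) :* (b :+ t))
             refl n (∑ℚ hs (λ h → f h * g h)) (∑ℚ hs f) (∑ℚ hs g) (f x) (g x))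
          (cong (λ m → m * ∑ℚ (x ∷ hs) (λ h → f h * g h) - ∑ℚ (x ∷ hs) f * ∑ℚ (x ∷ hs) g) (≡-sym (ℕ→ℚ-suc (length hs))))

  -- By induction on r: binomial h (1 + r) is binomial h r · (h - r) / (1 + r), a product of two factors that are
  -- monotone in h, so Chebyshev's inequality combines the bounds for binomial h r and for h - r.
  binomial-jensenℚ : ∀ r {a} hs → ℕ→ℚ r ≤ a → ℕ→ℚ (length hs) * a ≤ ∑ℚ hs ℕ→ℚ →
    ℕ→ℚ (length hs) * chooseℚ a r ≤ ∑ℚ hs (λ h → ℕ→ℚ (binomial h r))
  binomial-jensenℚ zero    hs       _     _ = ≤-reflexive (≡-sym (∑ℚ-const hs 1ℚ))
  binomial-jensenℚ (suc r) {a} []   _     _ = ≤-reflexive (*-zeroˡ (chooseℚ a (suc r)))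
  binomial-jensenℚ (suc r) {a} hs@(_ ∷ xs) 1+r≤a Na≤∑h = begin
    N * chooseℚ a (suc r)
      ≡⟨ *-assoc N (C * (a - ℕ→ℚ r)) (1/suc r) ⟨
    N * (C * (a - ℕ→ℚ r)) * 1/suc r
      ≤⟨ *-monoʳ-≤-0≤ (1/suc-nonNeg r) (*-cancelˡ-≤-pos N {{ℕ→ℚ-pos (length xs)}} N²Cw≤N∑uw) ⟩
    ∑ℚ hs (λ h → u h * w h) * 1/suc r
      ≡⟨ ∑ℚ-*ʳ hs (λ h → u h * w h) (1/suc r) ⟨
    ∑ℚ hs (λ h → u h * w h * 1/suc r)
      ≡⟨ ∑ℚ-cong hs (λ h → trans (cong (λ z → z * w h * 1/suc r) (≡-sym (chooseℚ[n,r]≡binomial[n,r] h r)))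
                                 (chooseℚ[n,r]≡binomial[n,r] h (suc r))) ⟩
    ∑ℚ hs (λ h → ℕ→ℚ (binomial h (suc r))) ∎
    where
    open ≤-Reasoning
    N = ℕ→ℚ (length hs)
    C = chooseℚ a r
    u w : ℕ → ℚ
    u h = ℕ→ℚ (binomial h r)
    w h = ℕ→ℚ h - ℕ→ℚ r
    r≤a = ≤-trans (ℕ→ℚ-mono-≤ (ℕ.n≤1+n r)) 1+r≤a
    NC≤∑u : N * C ≤ ∑ℚ hs u
    NC≤∑u = binomial-jensenℚ r hs r≤a Na≤∑h
    N[a-r]≤∑w : N * (a - ℕ→ℚ r) ≤ ∑ℚ hs w
    N[a-r]≤∑w = begin
      N * (a - ℕ→ℚ r)                 ≡⟨ *-distribˡ-+ N a (- ℕ→ℚ r) ⟩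
      N * a + N * - ℕ→ℚ r              ≤⟨ +-monoˡ-≤ (N * - ℕ→ℚ r) Na≤∑h ⟩
      ∑ℚ hs ℕ→ℚ + N * - ℕ→ℚ r          ≡⟨ cong (∑ℚ hs ℕ→ℚ +_) (∑ℚ-const hs (- ℕ→ℚ r)) ⟨
      ∑ℚ hs ℕ→ℚ + ∑ℚ hs (λ _ → - ℕ→ℚ r) ≡⟨ ∑ℚ-+ hs ℕ→ℚ (λ _ → - ℕ→ℚ r) ⟨
      ∑ℚ hs w                          ∎
    N²Cw≤N∑uw : N * (N * (C * (a - ℕ→ℚ r))) ≤ N * ∑ℚ hs (λ h → u h * w h)
    N²Cw≤N∑uw = begin
      N * (N * (C * (a - ℕ→ℚ r)))
        ≡⟨ solve 3 (λ n c d → n :* (n :* (c :* d)) := (n :* c) :* (n :* d)) refl N C (a - ℕ→ℚ r) ⟩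
      N * C * (N * (a - ℕ→ℚ r))
        ≤⟨ *-mono-≤-nonNeg (*-nonNeg (ℕ→ℚ-nonNeg (length hs)) (chooseℚ-nonNeg r r≤a))
                           (≤-trans (*-nonNeg (ℕ→ℚ-nonNeg (length hs)) (p≤q⇒0≤q-p r≤a)) N[a-r]≤∑w)
                           NC≤∑u N[a-r]≤∑w ⟩
      ∑ℚ hs u * ∑ℚ hs w
        ≤⟨ chebyshev (ℕ→ℚ-mono-≤ ∘ binomial-monoˡ-≤ r) (+-monoˡ-≤ (- ℕ→ℚ r) ∘ ℕ→ℚ-mono-≤) hs ⟩
      N * ∑ℚ hs (λ h → u h * w h) ∎

  binomial-jensen : ∀ r {a} hs → ℕ→ℚ r ≤ a → ℕ→ℚ (length hs) * a ≤ ℕ→ℚ (∑ hs id) →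
    ℕ→ℚ (length hs) * chooseℚ a r ≤ ℕ→ℚ (∑ hs (λ h → binomial h r))
  binomial-jensen r {a} hs r≤a Na≤∑h =
    subst (ℕ→ℚ (length hs) * chooseℚ a r ≤_) (≡-sym (ℕ→ℚ-∑ hs (λ h → binomial h r)))
      (binomial-jensenℚ r hs r≤a (subst (ℕ→ℚ (length hs) * a ≤_) (ℕ→ℚ-∑ hs id) Na≤∑h))

module Sums where

  open import Data.Bool using (Bool; true; false; _∧_; T)
  open import Data.Bool.ListAction using (all; any)
  open import Data.Nat as ℕ using (ℕ; zero; suc)
  import Data.Nat.Properties as ℕ
  open import Data.List using (List; []; _∷_; _++_; map; length; filterᵇ)
  open import Data.List.Membership.Propositional using (_∈_)
  open import Data.List.Relation.Unary.Any using (here; there)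
  open import Data.List.Relation.Unary.All as All using (All; []; _∷_)
  open import Data.List.Relation.Unary.All.Properties using (All¬⇒¬Any)
  open import Data.List.Relation.Unary.AllPairs using (AllPairs; []; _∷_)
  open import Data.List.Relation.Unary.Unique.Propositional using (Unique)
  open import Function using (_∘_; Equivalence)
  open import Relation.Nullary using (¬_; does; yes; no; contradiction)
  open import Relation.Binary.Definitions using (DecidableEquality)
  open import Relation.Binary.PropositionalEquality using (_≡_; refl; cong; cong₂; sym; module ≡-Reasoning)
  open RationalBinomial using (binomial)
  open Choices
  open Combinations
  open Equivalence using (to)

  open BigOperator ℕ.+-0-commutativeMonoid public using ()
    renaming (⨁ to ∑; ⨁-cong to ∑-cong; ⨁-cong-∈ to ∑-cong-∈; ⨁-++ to ∑-++; ⨁-map to ∑-map; ⨁-ε to ∑-0;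
              ⨁-swap to ∑-swap; ⨁-cartesianProductWith to ∑-cartesianProductWith; ⨁-choices-insert to ∑-choices-insert)

  private variable
    A : Set

  indicator : Bool → ℕ
  indicator true  = 1
  indicator false = 0

  ∑-combinations-all : ∀ (p : A → Bool) r xs →
    ∑ (combinations r xs) (λ S → indicator (all p S)) ≡ binomial (∑ xs (λ x → indicator (p x))) r
  ∑-combinations-all p zero    xs       = refl
  ∑-combinations-all p (suc r) []       = refl
  ∑-combinations-all p (suc r) (x ∷ xs) = begin
    ∑ (map (x ∷_) (combinations r xs) ++ combinations (suc r) xs) (λ S → indicator (all p S))
      ≡⟨ ∑-++ (map (x ∷_) (combinations r xs)) (combinations (suc r) xs) _ ⟩
    ∑ (map (x ∷_) (combinations r xs)) (λ S → indicator (all p S)) ℕ.+ ∑ (combinations (suc r) xs) (λ S → indicator (all p S))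
      ≡⟨ cong₂ ℕ._+_ (∑-map (x ∷_) (combinations r xs) _) (∑-combinations-all p (suc r) xs) ⟩
    ∑ (combinations r xs) (λ S → indicator (p x ∧ all p S)) ℕ.+ binomial (∑ xs (λ x → indicator (p x))) (suc r)
      ≡⟨ split (p x) ⟩
    binomial (∑ (x ∷ xs) (λ x → indicator (p x))) (suc r) ∎
    where
    open ≡-Reasoning
    split : ∀ b → ∑ (combinations r xs) (λ S → indicator (b ∧ all p S)) ℕ.+ binomial (∑ xs (λ x → indicator (p x))) (suc r)
                  ≡ binomial (indicator b ℕ.+ ∑ xs (λ x → indicator (p x))) (suc r)
    split true  = cong (ℕ._+ binomial (∑ xs (λ x → indicator (p x))) (suc r)) (∑-combinations-all p r xs)
    split false = cong (ℕ._+ binomial (∑ xs (λ x → indicator (p x))) (suc r)) (∑-0 (combinations r xs))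

  length-filterᵇ : ∀ (p : A → Bool) xs → length (filterᵇ p xs) ≡ ∑ xs (λ x → indicator (p x))
  length-filterᵇ p []       = refl
  length-filterᵇ p (x ∷ xs) with p x
  ... | true  = cong suc (length-filterᵇ p xs)
  ... | false = length-filterᵇ p xs

  ∑-indicator-none : ∀ (p : A → Bool) {xs} → All (λ x → ¬ T (p x)) xs → ∑ xs (λ x → indicator (p x)) ≡ 0
  ∑-indicator-none p {[]}     []           = refl
  ∑-indicator-none p {x ∷ xs} (¬px ∷ ¬pxs) with p x
  ... | true  = contradiction _ ¬px
  ... | false = ∑-indicator-none p ¬pxs

  indicator-any : ∀ (p : A → Bool) {xs} → AllPairs (λ x y → T (p x) → ¬ T (p y)) xs →
    indicator (any p xs) ≡ ∑ xs (λ x → indicator (p x))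
  indicator-any p {[]}     []              = refl
  indicator-any p {x ∷ xs} (px⇒¬py ∷ pxs) with p x
  ... | true  = cong suc (sym (∑-indicator-none p (All.map (λ px⇒¬py → px⇒¬py _) px⇒¬py)))
  ... | false = indicator-any p pxs

  ∑-indicator-≟ : ∀ (_≟_ : DecidableEquality A) {xs x} → Unique xs → x ∈ xs →
    ∑ xs (λ y → indicator (does (y ≟ x))) ≡ 1
  ∑-indicator-≟ _≟_ {y ∷ ys} (y∉ys ∷ ys!) (here refl) with y ≟ y
  ... | yes _   =
    cong suc (∑-indicator-none (λ z → does (z ≟ y)) (All.map (λ y≢z → y≢z ∘ sym ∘ to (T-does⇔ (_ ≟ y))) y∉ys))
  ... | no y≢y = contradiction refl y≢y
  ∑-indicator-≟ _≟_ {y ∷ ys} {x} (y∉ys ∷ ys!) (there x∈ys) with y ≟ x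
  ... | yes refl = contradiction x∈ys (All¬⇒¬Any y∉ys)
  ... | no _     = ∑-indicator-≟ _≟_ ys! x∈ys

  ∑-1≡length : ∀ (xs : List A) → ∑ xs (λ _ → 1) ≡ length xs
  ∑-1≡length []       = refl
  ∑-1≡length (x ∷ xs) = cong suc (∑-1≡length xs)

module Configurations where

  open import Data.Bool using (Bool)
  open import Data.Bool.Properties using (∧-commutativeMonoid; ∧-identityʳ)
  open import Data.Bool.ListAction using (all)
  open import Data.Nat as ℕ using (ℕ; _^_)
  import Data.Nat.Properties as ℕ
  open import Data.List using (List; []; _∷_; _++_; [_]; map; length; cartesianProductWith)
  open import Data.List.Properties using (++-assoc; length-map)
  open import Data.List.Relation.Unary.Linked using (Linked; _∷_)
  open import Data.Rational using (ℚ; _≤_; _*_)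
  import Data.Rational.Properties as ℚ
  open import Relation.Binary.PropositionalEquality using (_≡_; cong; trans; sym; subst; subst₂; module ≡-Reasoning)
  open import Defs using (ℕ→ℚ; chooseℚ)
  open RationalBinomial using (binomial; [c*binomial[n,s]*p]*a≤[c*n^s*p]*chooseℚ[a,s])
  open Choices
  open Combinations
  open Jensen using (binomial-jensen)
  open Sums

  open BigOperator ∧-commutativeMonoid using ()
    renaming (⨁-choices-split to all-choices-split; ⨁-cartesianProductWith to all-cartesianProductWith)

  private variable
    A : Set

  singletons : List A → List (List A)
  singletons = map [_]

  ∑-all-choices-singletons : ∀ (p : List A → Bool) Us →
    ∑ (choices (map singletons Us)) (λ c → indicator (all p (choices c))) ≡ ∑ (choices Us) (λ ρ → indicator (p ρ))
  ∑-all-choices-singletons p []       = cong (λ b → indicator b ℕ.+ 0) (∧-identityʳ (p []))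
  ∑-all-choices-singletons p (U ∷ Us) = begin
    ∑ (choices (singletons U ∷ Zs)) (λ c → indicator (all p (choices c)))
      ≡⟨ ∑-cartesianProductWith _∷_ (singletons U) (choices Zs) _ ⟩
    ∑ (singletons U) (λ S → ∑ (choices Zs) (λ c → indicator (all p (choices (S ∷ c)))))
      ≡⟨ ∑-map [_] U _ ⟩
    ∑ U (λ x → ∑ (choices Zs) (λ c → indicator (all p (choices ([ x ] ∷ c)))))
      ≡⟨ ∑-cong U (λ x → ∑-cong (choices Zs) (λ c → cong indicator
           (trans (all-cartesianProductWith _∷_ [ x ] (choices c) p) (∧-identityʳ _)))) ⟩
    ∑ U (λ x → ∑ (choices Zs) (λ c → indicator (all (λ ρ → p (x ∷ ρ)) (choices c))))
      ≡⟨ ∑-cong U (λ x → ∑-all-choices-singletons (λ ρ → p (x ∷ ρ)) Us) ⟩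
    ∑ U (λ x → ∑ (choices Us) (λ ρ → indicator (p (x ∷ ρ))))
      ≡⟨ ∑-cartesianProductWith _∷_ U (choices Us) _ ⟨
    ∑ (choices (U ∷ Us)) (λ ρ → indicator (p ρ)) ∎
    where
    open ≡-Reasoning
    Zs = map singletons Us

  leadingBinomials : ℕ → ℕ → List ℕ → ℕ
  leadingBinomials r n []       = 1
  leadingBinomials r n (m ∷ ms) = binomial n r ℕ.* leadingBinomials r m ms

  module Counting {V : Set} (Edge : List V → Bool) where

    complete : List (List V) → Bool
    complete c = all Edge (choices c)

    completeCount : List (List (List V)) → ℕ
    completeCount Ys = ∑ (choices Ys) (λ c → indicator (complete c))

    degree : List (List V) → List (List V) → List V → ℕ
    degree c d U = ∑ U (λ x → indicator (complete (c ++ [ x ] ∷ d)))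

    completeCount-singletons : ∀ Xs U Ys →
      completeCount (Xs ++ singletons U ∷ Ys) ≡ ∑ (choices Xs) (λ c → ∑ (choices Ys) (λ d → degree c d U))
    completeCount-singletons Xs U Ys =
      trans (∑-choices-insert Xs (singletons U) Ys _)
            (∑-cong (choices Xs) (λ c → ∑-cong (choices Ys) (λ d → ∑-map [_] U _)))

    completeCount-combinations : ∀ r Xs U Ys →
      completeCount (Xs ++ combinations r U ∷ Ys) ≡ ∑ (choices Xs) (λ c → ∑ (choices Ys) (λ d → binomial (degree c d U) r))
    completeCount-combinations r Xs U Ys =
      trans (∑-choices-insert Xs (combinations r U) Ys _)
            (∑-cong (choices Xs) (λ c → ∑-cong (choices Ys) (λ d →
              trans (∑-cong (combinations r U) (λ S → cong indicator (all-choices-split c S d Edge)))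
                    (∑-combinations-all (λ x → complete (c ++ [ x ] ∷ d)) r U))))

    degrees : List (List (List V)) → List V → List (List (List V)) → List ℕ
    degrees Xs U Ys = cartesianProductWith (λ c d → degree c d U) (choices Xs) (choices Ys)

    completeCount-step : ∀ r {a} Xs U Ys → ℕ→ℚ r ≤ a →
      ℕ→ℚ (length (choices Xs) ℕ.* length (choices Ys)) * a ≤ ℕ→ℚ (completeCount (Xs ++ singletons U ∷ Ys)) →
      ℕ→ℚ (length (choices Xs) ℕ.* length (choices Ys)) * chooseℚ a r ≤ ℕ→ℚ (completeCount (Xs ++ combinations r U ∷ Ys))
    completeCount-step r {a} Xs U Ys r≤a hyp =
      subst₂ (λ N c → ℕ→ℚ N * chooseℚ a r ≤ ℕ→ℚ c) #degrees ∑binomial-degrees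
        (binomial-jensen r (degrees Xs U Ys) r≤a (subst₂ (λ N c → ℕ→ℚ N * a ≤ ℕ→ℚ c) (sym #degrees) (sym ∑degrees) hyp))
      where
      #degrees : length (degrees Xs U Ys) ≡ length (choices Xs) ℕ.* length (choices Ys)
      #degrees = length-cartesianProductWith _ (choices Xs) (choices Ys)
      ∑degrees : ∑ (degrees Xs U Ys) (λ h → h) ≡ completeCount (Xs ++ singletons U ∷ Ys)
      ∑degrees = trans (∑-cartesianProductWith _ (choices Xs) (choices Ys) (λ h → h)) (sym (completeCount-singletons Xs U Ys))
      ∑binomial-degrees : ∑ (degrees Xs U Ys) (λ h → binomial h r) ≡ completeCount (Xs ++ combinations r U ∷ Ys)
      ∑binomial-degrees = trans (∑-cartesianProductWith _ (choices Xs) (choices Ys) (λ h → binomial h r))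
                                (sym (completeCount-combinations r Xs U Ys))

    module _ (r : ℕ) .{{_ : ℕ.NonZero r}} {a : ℚ} (r≤a : ℕ→ℚ r ≤ a) where

      -- Passing from U to the next part U′ keeps the average degree at least a, since
      -- a · binomial |U| r ≤ chooseℚ a r · |U| ^ r = chooseℚ a r · |U′|.
      completeCount-iterate : ∀ Xs U Us → Linked (λ n m → m ≡ n ^ r) (length U ∷ map length Us) →
        ℕ→ℚ (length (choices Xs) ℕ.* length (choices (map singletons Us))) * a
          ≤ ℕ→ℚ (completeCount (Xs ++ singletons U ∷ map singletons Us)) →
        ℕ→ℚ (length (choices Xs) ℕ.* leadingBinomials r (length U) (map length Us)) * chooseℚ a r
          ≤ ℕ→ℚ (completeCount (Xs ++ map (combinations r) (U ∷ Us)))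
      completeCount-iterate Xs U []        _                    hyp = completeCount-step r Xs U [] r≤a hyp
      completeCount-iterate Xs U (U′ ∷ Us) (|U′|≡|U|^r ∷ chain) hyp =
        subst₂ (λ N Ys → ℕ→ℚ N * chooseℚ a r ≤ ℕ→ℚ (completeCount Ys))
          #Xs′*leading (++-assoc Xs [ combinations r U ] (map (combinations r) (U′ ∷ Us)))
          (completeCount-iterate Xs′ U′ Us chain hyp′)
        where
        Xs′ = Xs ++ [ combinations r U ]
        Zs  = map singletons Us
        c = length (choices Xs)
        p = length (choices Zs)
        #Xs′ : length (choices Xs′) ≡ c ℕ.* binomial (length U) r
        #Xs′ = trans (length-choices-++ Xs _) (cong (c ℕ.*_)
                 (trans (length-cartesianProductWith _∷_ (combinations r U) (choices []))
                        (trans (ℕ.*-identityʳ _) (length-combinations r U))))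
        #Xs′*leading : length (choices Xs′) ℕ.* leadingBinomials r (length U′) (map length Us)
                     ≡ c ℕ.* leadingBinomials r (length U) (map length (U′ ∷ Us))
        #Xs′*leading = trans (cong (ℕ._* leadingBinomials r (length U′) (map length Us)) #Xs′) (ℕ.*-assoc c _ _)
        #U′∷Zs : length (choices (singletons U′ ∷ Zs)) ≡ length U ^ r ℕ.* p
        #U′∷Zs = trans (length-cartesianProductWith _∷_ (singletons U′) (choices Zs))
                       (cong (ℕ._* p) (trans (length-map [_] U′) |U′|≡|U|^r))
        hyp′ : ℕ→ℚ (length (choices Xs′) ℕ.* p) * a ≤ ℕ→ℚ (completeCount (Xs′ ++ singletons U′ ∷ Zs))
        hyp′ = ℚ.≤-trans
          (subst₂ (λ N M → ℕ→ℚ N * a ≤ ℕ→ℚ M * chooseℚ a r)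
             (cong (ℕ._* p) (sym #Xs′)) (cong (c ℕ.*_) (sym #U′∷Zs))
             ([c*binomial[n,s]*p]*a≤[c*n^s*p]*chooseℚ[a,s] r c (length U) p r≤a))
          (subst (λ Ys → ℕ→ℚ (c ℕ.* length (choices (singletons U′ ∷ Zs))) * chooseℚ a r ≤ ℕ→ℚ (completeCount Ys))
             (sym (++-assoc Xs [ combinations r U ] (singletons U′ ∷ Zs)))
             (completeCount-step r Xs U (singletons U′ ∷ Zs) r≤a hyp))

module SubsetLists where

  open import Data.Bool using (Bool; true; false; T)
  open import Data.Bool.Properties using (T?; T-≡)
  open import Data.Nat using (ℕ; zero; suc)
  open import Data.Fin as Fin using (Fin; zero; suc; cast)
  open import Data.Fin.Properties using (cast-involutive)
  open import Data.Fin.Subset as Subset using (Subset; ∣_∣)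
  open import Data.List using (List; []; _∷_; length; filterᵇ; tabulate; allFin; lookup)
  open import Data.List.Membership.Propositional using (_∈_)
  open import Data.List.Membership.Propositional.Properties using (∈-filter⁺; ∈-filter⁻; ∈-allFin; ∈-lookup)
  open import Data.List.Membership.DecPropositional using () renaming (_∈?_ to ∈?)
  open import Data.List.Relation.Unary.Any using (here; index)
  open import Data.List.Relation.Unary.Any.Properties using (lookup-index)
  open import Data.List.Relation.Unary.AllPairs using (_∷_)
  open import Data.List.Relation.Unary.All.Properties using (All¬⇒¬Any)
  open import Data.List.Relation.Unary.Unique.Propositional using (Unique)
  open import Data.List.Relation.Unary.Unique.Propositional.Properties using (filter⁺; allFin⁺)
  open import Data.Vec as Vec using (Vec)
  open import Data.Vec.Properties using ([]=⇒lookup; lookup⇒[]=; lookup∘tabulate; tabulate∘lookup)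
  open import Data.Product using (∃; _×_; _,_; proj₂)
  open import Function using (_∘_; _⇔_; mk⇔; Equivalence)
  open import Function.Construct.Composition using (_⇔-∘_)
  open import Relation.Nullary using (does; contradiction)
  open import Relation.Binary.PropositionalEquality using (_≡_; refl; cong; trans; sym; subst; module ≡-Reasoning)
  open Choices using (T-does⇔)
  open Equivalence using (to; from)

  private variable
    n r : ℕ
    A : Set

  ∈-Subset⇔lookup : ∀ {p : Subset n} {v} → v Subset.∈ p ⇔ T (Vec.lookup p v)
  ∈-Subset⇔lookup {p = p} {v} = mk⇔
    (λ v∈p → from T-≡ ([]=⇒lookup v∈p))
    (λ pv → lookup⇒[]= v p (to T-≡ pv))

  ∈-tabulate⇔ : ∀ {f : Fin n → Bool} {v} → v Subset.∈ Vec.tabulate f ⇔ T (f v)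
  ∈-tabulate⇔ {f = f} {v} rewrite sym (lookup∘tabulate f v) = ∈-Subset⇔lookup

  ∣tabulate∣≡length-filterᵇ : ∀ (p : A → Bool) (g : Fin n → A) → ∣ Vec.tabulate (p ∘ g) ∣ ≡ length (filterᵇ p (tabulate g))
  ∣tabulate∣≡length-filterᵇ {n = zero}  p g = refl
  ∣tabulate∣≡length-filterᵇ {n = suc n} p g with p (g zero)
  ... | true  = cong suc (∣tabulate∣≡length-filterᵇ p (g ∘ suc))
  ... | false = ∣tabulate∣≡length-filterᵇ p (g ∘ suc)

  elements : Subset n → List (Fin n)
  elements {n} p = filterᵇ (Vec.lookup p) (allFin n)

  ∈-elements⇔ : ∀ {p : Subset n} {v} → v ∈ elements p ⇔ v Subset.∈ p
  ∈-elements⇔ {n} {p} {v} = mk⇔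
    (from ∈-Subset⇔lookup ∘ proj₂ ∘ ∈-filter⁻ (T? ∘ Vec.lookup p) {xs = allFin n})
    (∈-filter⁺ (T? ∘ Vec.lookup p) (∈-allFin v) ∘ to ∈-Subset⇔lookup)

  elements⁺ : ∀ (p : Subset n) → Unique (elements p)
  elements⁺ {n} p = filter⁺ (T? ∘ Vec.lookup p) (allFin⁺ n)

  length-elements : ∀ (p : Subset n) → length (elements p) ≡ ∣ p ∣
  length-elements p = sym (trans (cong ∣_∣ (sym (tabulate∘lookup p))) (∣tabulate∣≡length-filterᵇ (Vec.lookup p) (λ v → v)))

  ∣p∣≡1⇒∃! : ∀ (p : Subset n) → ∣ p ∣ ≡ 1 → ∃ λ v → v Subset.∈ p × (∀ {w} → w Subset.∈ p → w ≡ v)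
  ∣p∣≡1⇒∃! p ∣p∣≡1 with elements p in elements≡ | trans (length-elements p) ∣p∣≡1
  ... | v ∷ [] | _ = v , ∈p (here refl) , λ w∈p → singleton (∈elements w∈p)
    where
    ∈p : ∀ {w} → w ∈ v ∷ [] → w Subset.∈ p
    ∈p w∈ = to ∈-elements⇔ (subst (_ ∈_) (sym elements≡) w∈)
    ∈elements : ∀ {w} → w Subset.∈ p → w ∈ v ∷ []
    ∈elements w∈p = subst (_ ∈_) elements≡ (from ∈-elements⇔ w∈p)
    singleton : ∀ {w} → w ∈ v ∷ [] → w ≡ v
    singleton (here w≡v) = w≡v

  fromList : List (Fin n) → Subset n
  fromList ρ = Vec.tabulate (λ v → does (∈? Fin._≟_ v ρ))

  ∈-fromList⇔ : ∀ {ρ : List (Fin n)} {v} → v Subset.∈ fromList ρ ⇔ v ∈ ρ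
  ∈-fromList⇔ {ρ = ρ} {v} = T-does⇔ (∈? Fin._≟_ v ρ) ⇔-∘ ∈-tabulate⇔

  lookup-injective : ∀ {xs : List A} → Unique xs → ∀ {s s′} → lookup xs s ≡ lookup xs s′ → s ≡ s′
  lookup-injective {xs = x ∷ xs} (x∉ ∷ xs!) {zero}  {zero}   _ = refl
  lookup-injective {xs = x ∷ xs} (x∉ ∷ xs!) {zero}  {suc s′} x≡ =
    contradiction (subst (_∈ xs) (sym x≡) (∈-lookup s′)) (All¬⇒¬Any x∉)
  lookup-injective {xs = x ∷ xs} (x∉ ∷ xs!) {suc s} {zero}   ≡x =
    contradiction (subst (_∈ xs) ≡x (∈-lookup s)) (All¬⇒¬Any x∉)
  lookup-injective {xs = x ∷ xs} (x∉ ∷ xs!) {suc s} {suc s′} eq = cong suc (lookup-injective xs! eq)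

  module Enumeration (S : List A) (|S|≡r : length S ≡ r) where

    enumerate : Fin r → A
    enumerate t = lookup S (cast (sym |S|≡r) t)

    enumerate-∈ : ∀ t → enumerate t ∈ S
    enumerate-∈ t = ∈-lookup (cast (sym |S|≡r) t)

    ∈⇒enumerate : ∀ {v} → v ∈ S → ∃ λ t → enumerate t ≡ v
    ∈⇒enumerate v∈S = cast |S|≡r (index v∈S) ,
      trans (cong (lookup S) (cast-involutive (sym |S|≡r) |S|≡r (index v∈S))) (sym (lookup-index v∈S))

    enumerate-injective : Unique S → ∀ {t t′} → enumerate t ≡ enumerate t′ → t ≡ t′
    enumerate-injective S! {t} {t′} eq = begin
      t                                      ≡⟨ cast-involutive |S|≡r (sym |S|≡r) t ⟨
      cast |S|≡r (cast (sym |S|≡r) t)        ≡⟨ cong (cast |S|≡r) (lookup-injective S! eq) ⟩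
      cast |S|≡r (cast (sym |S|≡r) t′)       ≡⟨ cast-involutive |S|≡r (sym |S|≡r) t′ ⟩
      t′                                     ∎
      where open ≡-Reasoning

module KPartite where

  open import Data.Bool using (Bool; T)
  import Data.Bool as Bool
  open import Data.Bool.Properties using (T?)
  open import Data.Bool.ListAction using (any)
  open import Data.Nat using (ℕ)
  open import Data.Fin as Fin using (Fin)
  open import Data.Fin.Subset as Subset using (Subset; _∩_)
  open import Data.Fin.Subset.Properties using (x∈p∩q⁺; x∈p∩q⁻; ⊆-antisym; _⊆?_)
  open import Data.List using (List; map; length; tabulate; allFin; concat; filterᵇ)
  import Data.List.Properties as List
  open import Data.List.Membership.Propositional using (_∈_)
  open import Data.List.Membership.Propositional.Properties
    using (∈-tabulate⁺; ∈-tabulate⁻; ∈-concat⁺′; ∈-concat⁻′; ∈-filter⁻)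
  open import Data.List.Relation.Unary.Any using (satisfied)
  open import Data.List.Relation.Unary.Any.Properties using (any⁻)
  open import Data.List.Relation.Unary.All as All using (All)
  import Data.List.Relation.Unary.All.Properties as All
  import Data.List.Relation.Unary.AllPairs as AllPairs
  open import Data.List.Relation.Unary.Unique.Propositional using (Unique)
  import Data.List.Relation.Unary.Unique.Propositional.Properties as Unique
  open import Data.List.Relation.Binary.Pointwise using (tabulate⁺)
  open import Data.Vec as Vec using (Vec; lookup)
  import Data.Vec.Properties as Vec
  open import Data.Product using (∃; _×_; _,_; proj₁; proj₂)
  open import Function using (id; _∘_; _⇔_; mk⇔; Equivalence; case_of_)
  open import Function.Construct.Composition using (_⇔-∘_)
  open import Relation.Nullary using (¬_; does)
  open import Relation.Nullary.Decidable using (does-⇔)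
  open import Relation.Binary.Definitions using (DecidableEquality)
  open import Relation.Binary.PropositionalEquality using (_≡_; _≢_; refl; cong; trans; sym; subst; module ≡-Reasoning)
  open import Defs using (partSet; DistinctEdges; IsKPartite; IsCopyOfK) renaming (_⇔_ to _⇔′_)
  open Choices
  open Combinations
  open Sums
  open Configurations
  open SubsetLists
  open Equivalence using (to; from)

  module Hypergraph {M m k : ℕ} (E : Vec (Subset M) m) (part : Fin M → Fin k) (kpartite : IsKPartite E part) where

    U : Fin k → List (Fin M)
    U i = elements (partSet part i)

    ∈partSet⇔ : ∀ {i v} → v Subset.∈ partSet part i ⇔ part v ≡ i
    ∈partSet⇔ {i} {v} = T-does⇔ (part v Fin.≟ i) ⇔-∘ ∈-tabulate⇔

    ∈U⇔ : ∀ {i v} → v ∈ U i ⇔ part v ≡ i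
    ∈U⇔ = ∈partSet⇔ ⇔-∘ ∈-elements⇔

    private
      uniqueVertex : ∀ j i → ∃ λ v → v Subset.∈ lookup E j ∩ partSet part i ×
                                     (∀ {w} → w Subset.∈ lookup E j ∩ partSet part i → w ≡ v)
      uniqueVertex j i = ∣p∣≡1⇒∃! (lookup E j ∩ partSet part i) (kpartite j i)

    vertex : Fin m → Fin k → Fin M
    vertex j i = proj₁ (uniqueVertex j i)

    vertex-∈ : ∀ j i → vertex j i Subset.∈ lookup E j
    vertex-∈ j i = proj₁ (x∈p∩q⁻ _ _ (proj₁ (proj₂ (uniqueVertex j i))))

    part-vertex : ∀ j i → part (vertex j i) ≡ i
    part-vertex j i = to ∈partSet⇔ (proj₂ (x∈p∩q⁻ _ _ (proj₁ (proj₂ (uniqueVertex j i)))))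

    vertex-unique : ∀ j {v} → v Subset.∈ lookup E j → v ≡ vertex j (part v)
    vertex-unique j {v} v∈Ej = proj₂ (proj₂ (uniqueVertex j (part v))) (x∈p∩q⁺ (v∈Ej , from ∈partSet⇔ refl))

    Us : List (List (Fin M))
    Us = tabulate U

    Us⁺ : All Unique Us
    Us⁺ = All.tabulate⁺ {f = U} (λ i → elements⁺ (partSet part i))

    transversal : Fin m → List (Fin M)
    transversal j = tabulate (vertex j)

    transversal-∈ : ∀ j → transversal j ∈ choices Us
    transversal-∈ j = ∈-choices⁺ (tabulate⁺ (λ i → from ∈U⇔ (part-vertex j i)))

    fromList-transversal : ∀ j → fromList (transversal j) ≡ lookup E j
    fromList-transversal j = ⊆-antisym
      (λ v∈ → case ∈-tabulate⁻ {f = vertex j} (to ∈-fromList⇔ v∈) of λ { (i , refl) → vertex-∈ j i })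
      (λ v∈Ej → from ∈-fromList⇔ (subst (_∈ transversal j) (sym (vertex-unique j v∈Ej)) (∈-tabulate⁺ _)))


    edge≡fromList⇔transversal : ∀ j {ρ} → ρ ∈ choices Us → (lookup E j ≡ fromList ρ) ⇔ (ρ ≡ transversal j)
    edge≡fromList⇔transversal j ρ∈ = mk⇔ (transversal-unique ρ∈ ∘ sym) (λ { refl → sym (fromList-transversal j) })
      where
      transversal-unique : ∀ {ρ} → ρ ∈ choices Us → fromList ρ ≡ lookup E j → ρ ≡ transversal j
      transversal-unique ρ∈ ρ≡Ej with ∈-choices-tabulate⁻ U ρ∈
      ... | f , refl , f∈U = List.tabulate-cong λ i → trans
        (vertex-unique j (subst (f i Subset.∈_) ρ≡Ej (from ∈-fromList⇔ (∈-tabulate⁺ i))))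
        (cong (vertex j) (to ∈U⇔ (f∈U i)))

    _≟ₛ_ : DecidableEquality (Subset M)
    _≟ₛ_ = Vec.≡-dec Bool._≟_

    _≟ₗ_ : DecidableEquality (List (Fin M))
    _≟ₗ_ = List.≡-dec Fin._≟_

    IsEdge : List (Fin M) → Bool
    IsEdge ρ = any (λ j → does (lookup E j ≟ₛ fromList ρ)) (allFin m)

    indicator-IsEdge : DistinctEdges E → ∀ ρ →
      indicator (IsEdge ρ) ≡ ∑ (allFin m) (λ j → indicator (does (lookup E j ≟ₛ fromList ρ)))
    indicator-IsEdge distinct ρ = indicator-any _ (AllPairs.map at-most-one (Unique.allFin⁺ m))
      where
      at-most-one : ∀ {j j′} → j ≢ j′ → T (does (lookup E j ≟ₛ fromList ρ)) → ¬ T (does (lookup E j′ ≟ₛ fromList ρ))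
      at-most-one j≢j′ Ej≡ρ Ej′≡ρ =
        j≢j′ (distinct _ _ (trans (to (T-does⇔ (_ ≟ₛ _)) Ej≡ρ) (sym (to (T-does⇔ (_ ≟ₛ _)) Ej′≡ρ))))

    ∑-edge≡fromList : ∀ j → ∑ (choices Us) (λ ρ → indicator (does (lookup E j ≟ₛ fromList ρ))) ≡ 1
    ∑-edge≡fromList j = begin
      ∑ (choices Us) (λ ρ → indicator (does (lookup E j ≟ₛ fromList ρ)))
        ≡⟨ ∑-cong-∈ (choices Us) (λ {ρ} ρ∈ → cong indicator
             (does-⇔ (edge≡fromList⇔transversal j ρ∈) (lookup E j ≟ₛ fromList ρ) (ρ ≟ₗ transversal j))) ⟩
      ∑ (choices Us) (λ ρ → indicator (does (ρ ≟ₗ transversal j)))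
        ≡⟨ ∑-indicator-≟ _≟ₗ_ (choices⁺ Us⁺) (transversal-∈ j) ⟩
      1 ∎
      where open ≡-Reasoning

    open Counting IsEdge

    completeCount-edges : DistinctEdges E → completeCount (map singletons Us) ≡ m
    completeCount-edges distinct = begin
      completeCount (map singletons Us)
        ≡⟨ ∑-all-choices-singletons IsEdge Us ⟩
      ∑ (choices Us) (λ ρ → indicator (IsEdge ρ))
        ≡⟨ ∑-cong (choices Us) (indicator-IsEdge distinct) ⟩
      ∑ (choices Us) (λ ρ → ∑ (allFin m) (λ j → indicator (does (lookup E j ≟ₛ fromList ρ))))
        ≡⟨ ∑-swap (choices Us) (allFin m) _ ⟩
      ∑ (allFin m) (λ j → ∑ (choices Us) (λ ρ → indicator (does (lookup E j ≟ₛ fromList ρ))))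
        ≡⟨ ∑-cong (allFin m) ∑-edge≡fromList ⟩
      ∑ (allFin m) (λ _ → 1)
        ≡⟨ ∑-1≡length (allFin m) ⟩
      length (allFin m)
        ≡⟨ List.length-tabulate id ⟩
      m ∎
      where open ≡-Reasoning

    module Copies (r : ℕ) where

      Ys : List (List (List (Fin M)))
      Ys = map (combinations r) Us

      W : List (List (Fin M)) → Subset M
      W c = fromList (concat c)

      F : List (List (Fin M)) → Subset m
      F c = Vec.tabulate (λ j → does (lookup E j ⊆? W c))

      -- decode (W c) recovers c, so different complete configurations span different copies.
      decode : Subset M → List (List (Fin M))
      decode S = tabulate (λ i → filterᵇ (lookup S) (U i))

      module Configuration (f : Fin k → List (Fin M)) (f∈ : ∀ i → f i ∈ combinations r (U i)) where

        part-∈ : ∀ {i v} → v ∈ f i → part v ≡ i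
        part-∈ {i} v∈fi = to ∈U⇔ (∈-combinations⇒⊆ r (U i) (f∈ i) v∈fi)

        ∈W⇔ : ∀ {v} → v Subset.∈ W (tabulate f) ⇔ v ∈ f (part v)
        ∈W⇔ {v} = mk⇔
          (λ v∈W → case ∈-concat⁻′ (tabulate f) (to ∈-fromList⇔ v∈W) of λ where
             (S , v∈S , S∈) → case ∈-tabulate⁻ S∈ of λ where
               (i , refl) → subst (λ i → v ∈ f i) (sym (part-∈ v∈S)) v∈S)
          (λ v∈f → from ∈-fromList⇔ (∈-concat⁺′ v∈f (∈-tabulate⁺ (part v))))

        ∈f⇒∈W : ∀ {i v} → v ∈ f i → v Subset.∈ W (tabulate f)
        ∈f⇒∈W v∈fi = from ∈W⇔ (subst (λ i → _ ∈ f i) (sym (part-∈ v∈fi)) v∈fi)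

        decode-W : decode (W (tabulate f)) ≡ tabulate f
        decode-W = List.tabulate-cong λ i → filterᵇ-combinations (lookup (W (tabulate f))) r (elements⁺ (partSet part i)) (f∈ i)
          (λ {v} v∈U v∈W → subst (λ i → v ∈ f i) (to ∈U⇔ v∈U)
                             (to ∈W⇔ (from (∈-Subset⇔lookup {p = W (tabulate f)}) v∈W)))
          (to (∈-Subset⇔lookup {p = W (tabulate f)}) ∘ ∈f⇒∈W)

        module Enum (i : Fin k) = Enumeration (f i) (∈-combinations⇒length r (U i) (f∈ i))

        φ : Fin k → Fin r → Fin M
        φ = Enum.enumerate

        φ-injective : ∀ i i′ t t′ → φ i t ≡ φ i′ t′ → i ≡ i′ × t ≡ t′
        φ-injective i i′ t t′ eq
          with trans (sym (part-∈ (Enum.enumerate-∈ i t))) (trans (cong part eq) (part-∈ (Enum.enumerate-∈ i′ t′)))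
        ... | refl = refl , Enum.enumerate-injective i (∈-combinations⇒Unique r (elements⁺ (partSet part i)) (f∈ i)) eq

        ∈W⇔φ : ∀ v → (v Subset.∈ W (tabulate f)) ⇔′ (∃ λ i → ∃ λ t → φ i t ≡ v)
        ∈W⇔φ v = (λ v∈W → part v , Enum.∈⇒enumerate (part v) (to ∈W⇔ v∈W))
               , λ { (i , t , refl) → ∈f⇒∈W (Enum.enumerate-∈ i t) }

        ∈F⇔ : ∀ {j} → j Subset.∈ F (tabulate f) ⇔ lookup E j Subset.⊆ W (tabulate f)
        ∈F⇔ {j} = T-does⇔ (lookup E j ⊆? W (tabulate f)) ⇔-∘ ∈-tabulate⇔

        EdgeImage : Fin m → (Fin k → Fin r) → Set
        EdgeImage j χ = (v : Fin M) → (v Subset.∈ lookup E j) ⇔′ (∃ λ i → φ i (χ i) ≡ v)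

        module _ (complete-c : T (complete (tabulate f))) where

          transversal-edge : (χ : Fin k → Fin r) → ∃ λ j → lookup E j ≡ fromList (tabulate (λ i → φ i (χ i)))
          transversal-edge χ with satisfied (any⁻ _ (allFin m) (All.lookup (All.all⁺ IsEdge _ complete-c) ρ∈))
            where ρ∈ = ∈-choices⁺ (tabulate⁺ {g = f} (λ i → Enum.enumerate-∈ i (χ i)))
          ... | j , Ej≡ρ = j , to (T-does⇔ (lookup E j ≟ₛ _)) Ej≡ρ

          isCopy : IsCopyOfK k r E (W (tabulate f)) (F (tabulate f))
          isCopy = (λ j j∈F v v∈Ej → to ∈F⇔ j∈F v∈Ej) , φ , φ-injective , ∈W⇔φ , edges⁺ , edges⁻
            where
            edges⁺ : (χ : Fin k → Fin r) → ∃ λ j → j Subset.∈ F (tabulate f) × EdgeImage j χ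
            edges⁺ χ with transversal-edge χ
            ... | j , Ej≡ρ = j , from ∈F⇔ Ej⊆W , ∈Ej⇔
              where
              ∈Ej⇔ : EdgeImage j χ
              ∈Ej⇔ v = (λ v∈Ej → case ∈-tabulate⁻ {f = λ i → φ i (χ i)} (to ∈-fromList⇔ (subst (v Subset.∈_) Ej≡ρ v∈Ej))
                                    of λ { (i , refl) → i , refl })
                     , λ { (i , refl) → subst (φ i (χ i) Subset.∈_) (sym Ej≡ρ) (from ∈-fromList⇔ (∈-tabulate⁺ i)) }
              Ej⊆W : lookup E j Subset.⊆ W (tabulate f)
              Ej⊆W v∈Ej with proj₁ (∈Ej⇔ _) v∈Ej
              ... | i , refl = ∈f⇒∈W (Enum.enumerate-∈ i (χ i))
            edges⁻ : (j : Fin m) → j Subset.∈ F (tabulate f) → ∃ λ χ → EdgeImage j χ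
            edges⁻ j j∈F = χ , λ v → (λ v∈Ej → part v , trans (φχ (part v)) (sym (vertex-unique j v∈Ej)))
                                   , λ { (i , refl) → subst (Subset._∈ lookup E j) (sym (φχ i)) (vertex-∈ j i) }
              where
              vertex∈f : ∀ i → vertex j i ∈ f i
              vertex∈f i = subst (λ i′ → vertex j i ∈ f i′) (part-vertex j i) (to ∈W⇔ (to ∈F⇔ j∈F (vertex-∈ j i)))
              χ : Fin k → Fin r
              χ i = proj₁ (Enum.∈⇒enumerate i (vertex∈f i))
              φχ : ∀ i → φ i (χ i) ≡ vertex j i
              φχ i = proj₂ (Enum.∈⇒enumerate i (vertex∈f i))

      choiceFunction : ∀ {c} → c ∈ choices Ys → ∃ λ f → c ≡ tabulate f × (∀ i → f i ∈ combinations r (U i))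
      choiceFunction {c} c∈ =
        ∈-choices-tabulate⁻ (combinations r ∘ U) (subst (λ Zs → c ∈ choices Zs) (List.map-tabulate U (combinations r)) c∈)

      completeConfigurations : List (List (List (Fin M)))
      completeConfigurations = filterᵇ complete (choices Ys)

      copies : List (Subset M × Subset m)
      copies = map (λ c → W c , F c) completeConfigurations

      length-copies : length copies ≡ completeCount Ys
      length-copies = trans (List.length-map _ completeConfigurations) (length-filterᵇ complete (choices Ys))

      private
        ∈completeConfigurations⁻ : ∀ {c} → c ∈ completeConfigurations → c ∈ choices Ys × T (complete c)
        ∈completeConfigurations⁻ = ∈-filter⁻ (T? ∘ complete) {xs = choices Ys}

      copies-IsCopyOfK : All (λ p → IsCopyOfK k r E (proj₁ p) (proj₂ p)) copies
      copies-IsCopyOfK = All.map⁺ (All.tabulate λ c∈ → case ∈completeConfigurations⁻ c∈ of λ where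
        (c∈Ys , complete-c) → case choiceFunction c∈Ys of λ where
          (f , refl , f∈) → Configuration.isCopy f f∈ complete-c)

      copies⁺ : Unique copies
      copies⁺ = map⁺-retraction (decode ∘ proj₁) decode-W
        (Unique.filter⁺ (T? ∘ complete) (choices⁺ (All.map⁺ (All.map (combinations⁺ r) Us⁺))))
        where
        decode-W : ∀ {c} → c ∈ completeConfigurations → decode (W c) ≡ c
        decode-W c∈ with choiceFunction (proj₁ (∈completeConfigurations⁻ c∈))
        ... | f , refl , f∈ = Configuration.decode-W f f∈

module PowerTower where

  open import Data.Nat as ℕ using (ℕ; zero; suc; _^_)
  import Data.Nat.Properties as ℕ
  open import Data.Nat.Combinatorics using (_C_)
  open import Data.Nat.ListAction using (product)
  open import Data.Fin as Fin using (Fin; toℕ)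
  open import Data.List using (List; []; _∷_; map; length; tabulate; applyUpTo)
  import Data.List.Properties as List
  open import Data.List.Relation.Unary.Linked using (Linked; [-]; _∷_)
  open import Relation.Binary.PropositionalEquality using (_≡_; refl; cong; cong₂; trans; sym; module ≡-Reasoning)
  open import Defs using (prodU2k; prodBinom1k)
  open RationalBinomial using (binomial; binomial≡C)
  open Choices using (choices; length-choices)
  open Configurations using (leadingBinomials; singletons)

  private variable
    A B : Set

  map-applyUpTo : ∀ (f : A → B) g n → map f (applyUpTo g n) ≡ tabulate {n = n} (λ i → f (g (toℕ i)))
  map-applyUpTo f g zero    = refl
  map-applyUpTo f g (suc n) = cong (f (g 0) ∷_) (map-applyUpTo f (λ i → g (suc i)) n)

  leadingBinomials-tabulate : ∀ r (s : ℕ → ℕ) k → leadingBinomials r (s 0) (tabulate {n = k} (λ i → s (suc (toℕ i))))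
    ≡ product (tabulate {n = k} (λ i → binomial (s (toℕ i)) r))
  leadingBinomials-tabulate r s zero    = refl
  leadingBinomials-tabulate r s (suc k) = cong (binomial (s 0) r ℕ.*_) (leadingBinomials-tabulate r (λ i → s (suc i)) k)

  linked-tabulate : ∀ {R : ℕ → ℕ → Set} (s : ℕ → ℕ) → (∀ i → R (s i) (s (suc i))) → ∀ k →
    Linked R (s 0 ∷ tabulate {n = k} (λ i → s (suc (toℕ i))))
  linked-tabulate s R-step zero    = [-]
  linked-tabulate s R-step (suc k) = R-step 0 ∷ linked-tabulate (λ i → s (suc i)) (λ i → R-step (suc i)) k

  module _ (n r : ℕ) {k′ : ℕ} (U : Fin (suc k′) → List A) (|U|≡ : ∀ i → length (U i) ≡ n ^ (r ^ suc (toℕ i))) where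

    private
      s : ℕ → ℕ
      s i = n ^ (r ^ suc i)

      lengths : map length (tabulate (λ i → U (Fin.suc i))) ≡ tabulate {n = k′} (λ i → s (suc (toℕ i)))
      lengths = trans (List.map-tabulate _ length) (List.tabulate-cong (λ i → |U|≡ (Fin.suc i)))

    sizes-linked : Linked (λ x y → y ≡ x ^ r) (length (U Fin.zero) ∷ map length (tabulate (λ i → U (Fin.suc i))))
    sizes-linked rewrite |U|≡ Fin.zero | lengths =
      linked-tabulate s (λ i → sym (trans (ℕ.^-*-assoc n (r ^ suc i) r) (cong (n ^_) (ℕ.*-comm (r ^ suc i) r)))) k′

    leadingBinomials≡prodBinom1k :
      leadingBinomials r (length (U Fin.zero)) (map length (tabulate (λ i → U (Fin.suc i)))) ≡ prodBinom1k n r (suc k′)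
    leadingBinomials≡prodBinom1k = begin
      leadingBinomials r (length (U Fin.zero)) (map length (tabulate (λ i → U (Fin.suc i))))
        ≡⟨ cong₂ (leadingBinomials r) (|U|≡ Fin.zero) lengths ⟩
      leadingBinomials r (s 0) (tabulate {n = k′} (λ i → s (suc (toℕ i))))
        ≡⟨ leadingBinomials-tabulate r s k′ ⟩
      product (tabulate {n = k′} (λ i → binomial (s (toℕ i)) r))
        ≡⟨ cong product (List.tabulate-cong {n = k′} (λ i → binomial≡C (s (toℕ i)) r)) ⟩
      product (tabulate {n = k′} (λ i → s (toℕ i) C r))
        ≡⟨ cong product (map-applyUpTo (λ j → n ^ (r ^ (1 ℕ.+ j)) C r) (λ j → j) k′) ⟨
      prodBinom1k n r (suc k′) ∎
      where open ≡-Reasoning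

    #choices-singletons≡prodU2k : length (choices (map singletons (tabulate (λ i → U (Fin.suc i))))) ≡ prodU2k n r (suc k′)
    #choices-singletons≡prodU2k = begin
      length (choices (map singletons (tabulate (λ i → U (Fin.suc i)))))
        ≡⟨ length-choices (map singletons (tabulate (λ i → U (Fin.suc i)))) ⟩
      product (map length (map singletons (tabulate (λ i → U (Fin.suc i)))))
        ≡⟨ cong product (trans (sym (List.map-∘ (tabulate (λ i → U (Fin.suc i))))) (List.map-tabulate _ _)) ⟩
      product (tabulate {n = k′} (λ i → length (singletons (U (Fin.suc i)))))
        ≡⟨ cong product (List.tabulate-cong (λ i → trans (List.length-map _ (U (Fin.suc i))) (|U|≡ (Fin.suc i)))) ⟩
      product (tabulate {n = k′} (λ i → s (suc (toℕ i))))
        ≡⟨ cong product (map-applyUpTo (λ j → n ^ (r ^ (2 ℕ.+ j))) (λ j → j) k′) ⟨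
      prodU2k n r (suc k′) ∎
      where open ≡-Reasoning

open import Defs
open import Data.Nat using (ℕ; suc; _≥_; _^_)
open import Data.Rational using (ℚ; _≤_; _*_)
open import Data.Fin using (Fin; toℕ)
open import Data.Fin.Subset using (Subset; ∣_∣)
open import Data.Vec using (Vec)
open import Data.List using (List; length)
open import Data.List.Relation.Unary.All using (All)
open import Data.List.Relation.Unary.Unique.Propositional using (Unique)
open import Data.Product using (_×_; ∃; proj₁; proj₂)
open import Relation.Binary.PropositionalEquality using (_≡_)

import Data.Nat as ℕ
import Data.Nat.Properties as ℕ
import Data.Rational.Properties as ℚ
import Data.Fin as Fin
open import Data.List using ([]; map; tabulate)
open import Data.Product using (_,_)
open import Relation.Binary.PropositionalEquality using (cong; trans; sym)
open Choices using (choices)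
open Configurations using (module Counting; singletons; leadingBinomials)
open SubsetLists using (length-elements)
open KPartite using (module Hypergraph)
open PowerTower

proposition1 : (r k n : ℕ) → r ≥ 1 → k ≥ 1 → n ≥ 1 →
    (M m : ℕ) (E : Vec (Subset M) m) → DistinctEdges E →
    (part : Fin M → Fin k) → IsKPartite E part →
    ((i : Fin k) → ∣ partSet part i ∣ ≡ n ^ (r ^ suc (toℕ i))) →
    (a : ℚ) → ℕ→ℚ r ≤ a → ℕ→ℚ m ≡ a * ℕ→ℚ (prodU2k n r k) →
    ∃ λ (copies : List (Subset M × Subset m)) →
      Unique copies × All (λ p → IsCopyOfK k r E (proj₁ p) (proj₂ p)) copies ×
      chooseℚ a r * ℕ→ℚ (prodBinom1k n r k) ≤ ℕ→ℚ (length copies)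
proposition1 r@(suc _) (suc k′) n _ _ _ M m E distinct part kpartite |partSet| a r≤a m≡a*∏ =
  copies , copies⁺ , copies-IsCopyOfK , (begin
    chooseℚ a r * ℕ→ℚ (prodBinom1k n r (suc k′))
      ≡⟨ trans (cong (λ x → ℕ→ℚ x * chooseℚ a r) (trans (ℕ.*-identityˡ _) (leadingBinomials≡prodBinom1k n r U |U|≡)))
               (ℚ.*-comm _ (chooseℚ a r)) ⟨
    ℕ→ℚ (1 ℕ.* leadingBinomials r (length (U Fin.zero)) (map length Us′)) * chooseℚ a r
      ≤⟨ completeCount-iterate r r≤a [] (U Fin.zero) Us′ (sizes-linked n r U |U|≡) (ℚ.≤-reflexive (begin-equality
           ℕ→ℚ (1 ℕ.* length (choices (map singletons Us′))) * a
             ≡⟨ cong (λ x → ℕ→ℚ x * a) (trans (ℕ.*-identityˡ _) (#choices-singletons≡prodU2k n r U |U|≡)) ⟩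
           ℕ→ℚ (prodU2k n r (suc k′)) * a
             ≡⟨ trans (ℚ.*-comm _ a) (sym m≡a*∏) ⟩
           ℕ→ℚ m
             ≡⟨ cong ℕ→ℚ (completeCount-edges distinct) ⟨
           ℕ→ℚ (completeCount (map singletons Us)) ∎)) ⟩
    ℕ→ℚ (completeCount Ys)
      ≡⟨ cong ℕ→ℚ length-copies ⟨
    ℕ→ℚ (length copies) ∎)
  where
  open Hypergraph E part kpartite
  open Copies r
  open Counting IsEdge
  open ℚ.≤-Reasoning
  Us′ = tabulate (λ i → U (Fin.suc i))
  |U|≡ : ∀ i → length (U i) ≡ n ^ (r ^ suc (toℕ i))
  |U|≡ i = trans (length-elements (partSet part i)) (|partSet| i)
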